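{- Let $n\geqslant 2$ and $k\geqslant n-2$, and let $e_i$ denote the $i$-th elementary symmetric function of $x_1,\ldots,x_{k+1}$ (with $e_0=1$). Then $$C_n(x_1,x_2,\ldots,x_{k+1})=\sum \gamma(n;i_1,i_2,\ldots,i_n)\,e_{k-n+2}^{i_n}e_{k-n+3}^{i_{n-1}}\cdots e_k^{i_2}e_{k+1}^{i_1},$$ where the summation is over all sequences $(i_1,\ldots,i_n)$ of nonnegative integers with $i_1+\cdots+i_n=n$, $1\leqslant i_1\leqslant n-1$, and $i_n\in\{0,1\}$, and where $i_n=1$ implies $i_1=n-1$. Moreover, $\gamma(n;i_1,\ldots,i_n)$ equals the number of 0-1-2-$\cdots$-$k$-$(k+1)$ increasing plane trees on $[n]$ having exactly $i_j$ vertices of degree $j-1$ for every $1\leqslant j\leqslant n$.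
   Context: $C_n(x_1,\ldots,x_{k+1})=\sum_{\sigma\in\mathcal{Q}_n(k)}x_1^{\mathrm{plat}_1(\sigma)}\cdots x_{k-1}^{\mathrm{plat}_{k-1}(\sigma)}x_k^{\mathrm{des}(\sigma)}x_{k+1}^{\mathrm{asc}(\sigma)}$, where: $\mathcal{Q}_n(k)$ is the set of $k$-Stirling permutations of order $n$, i.e. permutations $\sigma=\sigma_1\cdots\sigma_{kn}$ of the multiset $\{1^k,\ldots,n^k\}$ such that for each $i$ all entries between two occurrences of $i$ are at least $i$; with $\sigma_0=\sigma_{kn+1}=0$, an index $0\leqslant i\leqslant kn$ is an ascent/descent/plateau if $\sigma_i<\sigma_{i+1}$ / $\sigma_i>\sigma_{i+1}$ / $\sigma_i=\sigma_{i+1}$; a plateau $i$ is a $j$-plateau if exactly $j-1$ indices $\ell<i$ satisfy $\sigma_\ell=\sigma_i$; $\mathrm{asc},\mathrm{des},\mathrm{plat}_j$ count these. An increasing plane tree on $[n]$ is a rooted tree on vertex set $[n]$ with root $1$, in which the children of each vertex are linearly ordered and labels increase along every path from the root; the degree of a vertex is its number of children. A 0-1-2-$\cdots$-$m$ increasing plane tree is one in which every vertex has at most $m$ children. -}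

module Defs where

open import Data.Nat using (ℕ; zero; suc; _+_; _*_; _∸_; _^_; _≤_; _<_; _≡ᵇ_; _<ᵇ_; _≤ᵇ_)
open import Data.Bool using (Bool; true; false; _∧_; _∨_; not; if_then_else_)
open import Data.List using (List; []; _∷_; _++_; [_]; map; concatMap; length; upTo; filterᵇ)
open import Data.Bool.ListAction using (and)
open import Data.Nat.ListAction using (sum; product)
open import Data.List.Relation.Unary.All using (All)
open import Data.List.Relation.Unary.Unique.Propositional using (Unique)
open import Data.List.Membership.Propositional using (_∈_)
open import Data.List.Relation.Binary.Permutation.Propositional using (_↭_)
open import Data.Product using (Σ; _×_)
open import Relation.Binary.PropositionalEquality using (_≡_)

oneTo : ℕ → List ℕ
oneTo m = map suc (upTo m)

occ : ℕ → List ℕ → ℕ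
occ a []       = 0
occ a (b ∷ bs) = (if a ≡ᵇ b then 1 else 0) + occ a bs

nth : List ℕ → ℕ → ℕ
nth []       _       = 0
nth (a ∷ _)  zero    = a
nth (_ ∷ as) (suc i) = nth as i

words : ℕ → ℕ → List (List ℕ)
words zero    n = [] ∷ []
words (suc L) n = concatMap (λ v → map (v ∷_) (words L n)) (oneTo n)

seqs : ℕ → ℕ → List (List ℕ)
seqs zero    b = [] ∷ []
seqs (suc L) b = concatMap (λ v → map (v ∷_) (seqs L b)) (upTo (suc b))

-- no pattern  w_i = w_l > w_j  with  i < j < l, checked for the first letter a:
-- scanning the rest, once a letter < a has been seen, a must not occur again.
stirlingHead : ℕ → List ℕ → Bool → Bool
stirlingHead a []       seen = true
stirlingHead a (b ∷ bs) seen =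
  not (seen ∧ (a ≡ᵇ b)) ∧ stirlingHead a bs (seen ∨ (b <ᵇ a))

-- for every i, all entries between two occurrences of i are ≥ i
stirling : List ℕ → Bool
stirling []       = true
stirling (a ∷ w) = stirlingHead a w false ∧ stirling w

-- w is a permutation of the multiset {1^k,…,n^k} (given entries in [n])
multisetOK : ℕ → ℕ → List ℕ → Bool
multisetOK n k w = and (map (λ v → occ v w ≡ᵇ k) (oneTo n))

Q : ℕ → ℕ → List (List ℕ)
Q n k = filterᵇ (λ w → multisetOK n k w ∧ stirling w) (words (k * n) n)

pad : List ℕ → List ℕ
pad w = 0 ∷ (w ++ [ 0 ])

ascP : List ℕ → ℕ
ascP (a ∷ b ∷ r) = (if a <ᵇ b then 1 else 0) + ascP (b ∷ r)
ascP _           = 0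

desP : List ℕ → ℕ
desP (a ∷ b ∷ r) = (if b <ᵇ a then 1 else 0) + desP (b ∷ r)
desP _           = 0

-- j-plateaux of a padded word; `pre` holds σ_0 … σ_{i-1}
platP : ℕ → List ℕ → List ℕ → ℕ
platP j pre (a ∷ b ∷ r) =
  (if (a ≡ᵇ b) ∧ (suc (occ a pre) ≡ᵇ j) then 1 else 0) + platP j (a ∷ pre) (b ∷ r)
platP j pre _           = 0

asc : List ℕ → ℕ
asc σ = ascP (pad σ)

des : List ℕ → ℕ
des σ = desP (pad σ)

plat : ℕ → List ℕ → ℕ
plat j σ = platP j [] (pad σ)

weight : ℕ → (ℕ → ℕ) → List ℕ → ℕ
weight k x σ =
  product (map (λ j → x j ^ plat j σ) (oneTo (k ∸ 1))) * (x k ^ des σ) * (x (suc k) ^ asc σ)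

C : ℕ → ℕ → (ℕ → ℕ) → ℕ
C n k x = sum (map (weight k x) (Q n k))

esym : List ℕ → ℕ → ℕ
esym []       zero    = 1
esym []       (suc i) = 0
esym (y ∷ ys) zero    = 1
esym (y ∷ ys) (suc i) = y * esym ys i + esym ys (suc i)

e : ℕ → (ℕ → ℕ) → ℕ → ℕ
e k x i = esym (map x (oneTo (suc k))) i

-- index sequences (i_1,…,i_n), stored as a list of length n (i_j = nth is (j-1))
first lastOf : List ℕ → ℕ
first is = nth is 0
lastOf is = nth is (length is ∸ 1)

validSeq : ℕ → List ℕ → Bool
validSeq n is =
  (sum is ≡ᵇ n) ∧ (1 ≤ᵇ first is) ∧ (first is ≤ᵇ n ∸ 1) ∧ (lastOf is ≤ᵇ 1)
  ∧ (not (lastOf is ≡ᵇ 1) ∨ (first is ≡ᵇ n ∸ 1))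

-- all sequences of nonnegative integers of length n satisfying the conditions
-- (entries are automatically ≤ n since they sum to n)
Seqs : ℕ → List (List ℕ)
Seqs n = filterᵇ (validSeq n) (seqs n n)

-- e_{k-n+2}^{i_n} ⋯ e_k^{i_2} e_{k+1}^{i_1}  =  ∏_{j=1}^{n} e_{k+2-j}^{i_j}
eMono : ℕ → ℕ → (ℕ → ℕ) → List ℕ → ℕ
eMono n k x is = product (map (λ j → e k x (k + 2 ∸ j) ^ nth is (j ∸ 1)) (oneTo n))

data PTree : Set where
  node : ℕ → List PTree → PTree

rootLabel : PTree → ℕ
rootLabel (node a _) = a

mutual
  labels : PTree → List ℕ
  labels (node a ts) = a ∷ labelsF ts

  labelsF : List PTree → List ℕ
  labelsF []       = []
  labelsF (t ∷ ts) = labels t ++ labelsF ts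

mutual
  degCount : ℕ → PTree → ℕ
  degCount d (node a ts) = (if length ts ≡ᵇ d then 1 else 0) + degCountF d ts

  degCountF : ℕ → List PTree → ℕ
  degCountF d []       = 0
  degCountF d (t ∷ ts) = degCount d t + degCountF d ts

data Increasing : PTree → Set where
  inc : ∀ {a ts} → All (λ t → a < rootLabel t) ts → All Increasing ts →
        Increasing (node a ts)

data MaxDeg (m : ℕ) : PTree → Set where
  maxDeg : ∀ {a ts} → length ts ≤ m → All (MaxDeg m) ts → MaxDeg m (node a ts)

IncPlaneTree : ℕ → PTree → Set
IncPlaneTree n t = Increasing t × (labels t ↭ oneTo n)

GoodTree : ℕ → ℕ → List ℕ → PTree → Set
GoodTree n k is t =
  IncPlaneTree n t × MaxDeg (suc k) t × (∀ j → 1 ≤ j → j ≤ n → degCount (j ∸ 1) t ≡ nth is (j ∸ 1))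

IsCount : {A : Set} → (A → Set) → ℕ → Set
IsCount {A} P c =
  Σ (List A) λ L → Unique L × (∀ a → a ∈ L → P a) × (∀ a → P a → a ∈ L) × (length L ≡ c)

private
  open import Relation.Binary.PropositionalEquality using (refl)
  t1 : length (Q 3 2) ≡ 15
  t1 = refl
  t2 : C 2 1 (λ _ → 1) ≡ 2
  t2 = refl
  t3 : C 3 1 (λ i → suc i) ≡ 222
  t3 = refl
  t4 : Seqs 3 ≡ (1 ∷ 2 ∷ 0 ∷ []) ∷ (2 ∷ 0 ∷ 1 ∷ []) ∷ (2 ∷ 1 ∷ 0 ∷ []) ∷ []
  t4 = refl
  t5 : eMono 3 1 (λ i → suc i) (1 ∷ 2 ∷ 0 ∷ []) ≡ 150
  t5 = refl

-- Both sides equal Dⁿ⁻¹(x_1 x_2 ⋯ x_{k+1}) for the derivation D of the grammar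
-- x_i → x_1 x_2 ⋯ x_{k+1}. The weight of a k-Stirling permutation σ is x^c, where c counts the gaps of
-- the padded word of σ by type (ascent, descent, j-plateau). Inserting the block (n+1)^k into a gap of
-- type t replaces that gap by one gap of every type, which is the t-th term of D(x^c); as every
-- permutation of order n + 1 arises in exactly one way from one of order n, C_{n+1} = D C_n.
-- On the tree side a vertex with d children carries e_{k+1-d}, and D e_{k+1-d} = (d+1) e_{k-d} e_{k+1}:
-- growing an increasing tree by a new leaf in one of the d + 1 positions below a vertex raises its
-- degree and adds a leaf. So the sum over increasing plane trees on [n] of ∏ e_{k+1-deg} is also
-- Dⁿ⁻¹(e_{k+1}); grouping trees by degree profile gives the expansion, and n ≤ k + 2 makes the
-- degree bound k + 1 automatic.
module Submission where

open import Data.Bool using (Bool; true; false; if_then_else_; _∧_; _∨_; not; T)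
open import Data.Bool.ListAction using (and)
open import Data.Empty using (⊥-elim)
open import Data.List
  using (List; []; _∷_; _++_; _ʳ++_; [_]; map; concatMap; length; upTo; applyUpTo; replicate; take; drop;
         filter; filterᵇ)
open import Data.List.Properties
  using (++-assoc; ++-identityʳ; length-++; length-map; length-take; length-replicate; length-applyUpTo;
         map-++; map-∘; map-applyUpTo; map-upTo; map-cong-local; applyUpTo-∷ʳ; take++drop≡id;
         ∷-injectiveˡ; ∷-injectiveʳ; ≡-dec)
open import Data.List.Membership.Propositional using (_∈_; _∉_; find; lose)
open import Data.List.Membership.Propositional.Properties
open import Data.List.Membership.Propositional.Properties.WithK using (unique∧set⇒bag)
open import Data.List.Relation.Binary.BagAndSetEquality using (∼bag⇒↭)
open import Data.List.Relation.Binary.Permutation.Propositional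
  using (_↭_; ↭-refl; ↭-trans; ↭-sym; ↭-prep; ↭-swap)
import Data.List.Relation.Binary.Permutation.Propositional.Properties as ↭
open import Data.List.Relation.Unary.All using (All; []; _∷_)
import Data.List.Relation.Unary.All as All
import Data.List.Relation.Unary.All.Properties as All
open import Data.List.Relation.Unary.AllPairs using ([]; _∷_)
open import Data.List.Relation.Unary.Any using (here; there)
open import Data.List.Relation.Unary.Unique.Propositional using (Unique)
import Data.List.Relation.Unary.Unique.Propositional.Properties as Unique
open import Data.Nat
open import Data.Nat.ListAction using (sum; product)
open import Data.Nat.ListAction.Properties using (sum-↭; sum-++; product-++)
open import Data.Nat.Properties
open import Algebra.Properties.CommutativeSemigroup +-commutativeSemigroup
  using () renaming (interchange to +-interchange; x∙yz≈y∙xz to +-left-comm)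
open import Algebra.Properties.CommutativeSemigroup *-commutativeSemigroup
  using () renaming (interchange to *-interchange)
open import Data.Product using (∃; _×_; _,_; proj₁; proj₂)
open import Data.Sum using (_⊎_; inj₁; inj₂)
open import Data.Unit using (⊤; tt)
open import Function using (_∘_; id)
open import Function.Bundles using (mk⇔)
open import Relation.Binary.Definitions using (tri<; tri≈; tri>)
open import Relation.Binary.PropositionalEquality hiding ([_])
open import Relation.Nullary using (¬_; Dec; yes; no)
open import Relation.Nullary.Decidable using (T?)

open import Defs


∑ : {A : Set} → (A → ℕ) → List A → ℕ
∑ f xs = sum (map f xs)

∑< : ℕ → (ℕ → ℕ) → ℕ
∑< n f = sum (applyUpTo f n)

∏< : ℕ → (ℕ → ℕ) → ℕ
∏< n f = product (applyUpTo f n)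

module _ {A : Set} where

  ∑-++ : (f : A → ℕ) (xs ys : List A) → ∑ f (xs ++ ys) ≡ ∑ f xs + ∑ f ys
  ∑-++ f xs ys rewrite map-++ f xs ys = sum-++ (map f xs) (map f ys)

  ∑-cong : {f g : A → ℕ} (xs : List A) → (∀ a → a ∈ xs → f a ≡ g a) → ∑ f xs ≡ ∑ g xs
  ∑-cong [] h = refl
  ∑-cong (x ∷ xs) h = cong₂ _+_ (h x (here refl)) (∑-cong xs (λ a m → h a (there m)))

  ∑-ext : {f g : A → ℕ} (xs : List A) → (∀ a → f a ≡ g a) → ∑ f xs ≡ ∑ g xs
  ∑-ext xs h = ∑-cong xs (λ a _ → h a)

  ∑-0 : (xs : List A) → ∑ (λ _ → 0) xs ≡ 0
  ∑-0 [] = refl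
  ∑-0 (x ∷ xs) = ∑-0 xs

  ∑-1 : (xs : List A) → ∑ (λ _ → 1) xs ≡ length xs
  ∑-1 [] = refl
  ∑-1 (x ∷ xs) = cong suc (∑-1 xs)

  ∑-const : (c : ℕ) (xs : List A) → ∑ (λ _ → c) xs ≡ length xs * c
  ∑-const c [] = refl
  ∑-const c (x ∷ xs) = cong (c +_) (∑-const c xs)

  ∑-+ : (f g : A → ℕ) (xs : List A) → ∑ (λ a → f a + g a) xs ≡ ∑ f xs + ∑ g xs
  ∑-+ f g [] = refl
  ∑-+ f g (x ∷ xs) rewrite ∑-+ f g xs = +-interchange (f x) (g x) (∑ f xs) (∑ g xs)

  ∑-*ˡ : (c : ℕ) (f : A → ℕ) (xs : List A) → ∑ (λ a → c * f a) xs ≡ c * ∑ f xs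
  ∑-*ˡ c f [] = sym (*-zeroʳ c)
  ∑-*ˡ c f (x ∷ xs) rewrite ∑-*ˡ c f xs = sym (*-distribˡ-+ c (f x) (∑ f xs))

  ∑-*ʳ : (c : ℕ) (f : A → ℕ) (xs : List A) → ∑ (λ a → f a * c) xs ≡ ∑ f xs * c
  ∑-*ʳ c f [] = refl
  ∑-*ʳ c f (x ∷ xs) rewrite ∑-*ʳ c f xs = sym (*-distribʳ-+ c (f x) (∑ f xs))

  ∑-unique-cong : (f : A → ℕ) {xs ys : List A} → Unique xs → Unique ys →
                  (∀ z → z ∈ xs → z ∈ ys) → (∀ z → z ∈ ys → z ∈ xs) → ∑ f xs ≡ ∑ f ys
  ∑-unique-cong f ux uy xs⊆ys ys⊆xs =
    sum-↭ (↭.map⁺ f (∼bag⇒↭ (unique∧set⇒bag ux uy (mk⇔ (xs⊆ys _) (ys⊆xs _)))))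

module _ {A B : Set} where

  ∑-map : (f : B → ℕ) (g : A → B) (xs : List A) → ∑ f (map g xs) ≡ ∑ (f ∘ g) xs
  ∑-map f g [] = refl
  ∑-map f g (x ∷ xs) = cong (f (g x) +_) (∑-map f g xs)

  ∑-concatMap : (f : B → ℕ) (g : A → List B) (xs : List A) →
                ∑ f (concatMap g xs) ≡ ∑ (λ a → ∑ f (g a)) xs
  ∑-concatMap f g [] = refl
  ∑-concatMap f g (x ∷ xs) =
    trans (∑-++ f (g x) (concatMap g xs)) (cong (∑ f (g x) +_) (∑-concatMap f g xs))

  ∑-comm : (f : A → B → ℕ) (xs : List A) (ys : List B) →
           ∑ (λ a → ∑ (f a) ys) xs ≡ ∑ (λ b → ∑ (λ a → f a b) xs) ys
  ∑-comm f [] ys = sym (∑-0 ys)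
  ∑-comm f (x ∷ xs) ys =
    trans (cong (∑ (f x) ys +_) (∑-comm f xs ys)) (sym (∑-+ (f x) (λ b → ∑ (λ a → f a b) xs) ys))

∑-upTo : (f : ℕ → ℕ) (n : ℕ) → ∑ f (upTo n) ≡ ∑< n f
∑-upTo f n = cong sum (map-applyUpTo id f n)

∑<-cong : (n : ℕ) {f g : ℕ → ℕ} → (∀ i → i < n → f i ≡ g i) → ∑< n f ≡ ∑< n g
∑<-cong zero h = refl
∑<-cong (suc n) h = cong₂ _+_ (h 0 z<s) (∑<-cong n (λ i i<n → h (suc i) (s<s i<n)))

∑<-0 : (n : ℕ) → ∑< n (λ _ → 0) ≡ 0
∑<-0 zero = refl
∑<-0 (suc n) = ∑<-0 n

∑<-+ : (n : ℕ) (f g : ℕ → ℕ) → ∑< n (λ i → f i + g i) ≡ ∑< n f + ∑< n g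
∑<-+ n f g = trans (sym (∑-upTo _ n)) (trans (∑-+ f g (upTo n)) (cong₂ _+_ (∑-upTo f n) (∑-upTo g n)))

∏<-cong : (n : ℕ) {f g : ℕ → ℕ} → (∀ i → i < n → f i ≡ g i) → ∏< n f ≡ ∏< n g
∏<-cong zero h = refl
∏<-cong (suc n) h = cong₂ _*_ (h 0 z<s) (∏<-cong n (λ i i<n → h (suc i) (s<s i<n)))

∏<-1 : (n : ℕ) → ∏< n (λ _ → 1) ≡ 1
∏<-1 zero = refl
∏<-1 (suc n) = trans (+-identityʳ _) (∏<-1 n)

∏<-* : (n : ℕ) (f g : ℕ → ℕ) → ∏< n (λ i → f i * g i) ≡ ∏< n f * ∏< n g
∏<-* zero f g = refl
∏<-* (suc n) f g rewrite ∏<-* n (f ∘ suc) (g ∘ suc) = *-interchange (f 0) (g 0) (∏< n (f ∘ suc)) (∏< n (g ∘ suc))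

∏<-suc : (n : ℕ) (f : ℕ → ℕ) → ∏< (suc n) f ≡ ∏< n f * f n
∏<-suc n f = begin
  product (applyUpTo f (suc n))         ≡⟨ cong product (sym (applyUpTo-∷ʳ f n)) ⟩
  product (applyUpTo f n ++ [ f n ])    ≡⟨ product-++ (applyUpTo f n) [ f n ] ⟩
  ∏< n f * (f n * 1)                    ≡⟨ cong (∏< n f *_) (*-identityʳ (f n)) ⟩
  ∏< n f * f n                          ∎
  where open ≡-Reasoning


≡ᵇ-refl : (a : ℕ) → (a ≡ᵇ a) ≡ true
≡ᵇ-refl zero = refl
≡ᵇ-refl (suc a) = ≡ᵇ-refl a

≡ᵇ-sym : (a b : ℕ) → (a ≡ᵇ b) ≡ (b ≡ᵇ a)
≡ᵇ-sym zero zero = refl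
≡ᵇ-sym zero (suc b) = refl
≡ᵇ-sym (suc a) zero = refl
≡ᵇ-sym (suc a) (suc b) = ≡ᵇ-sym a b

≡ᵇ-true⇒≡ : (a b : ℕ) → (a ≡ᵇ b) ≡ true → a ≡ b
≡ᵇ-true⇒≡ a b e = ≡ᵇ⇒≡ a b (subst T (sym e) _)

≢⇒≡ᵇ-false : (a b : ℕ) → a ≢ b → (a ≡ᵇ b) ≡ false
≢⇒≡ᵇ-false a b a≢b with a ≡ᵇ b in eq
... | true = ⊥-elim (a≢b (≡ᵇ-true⇒≡ a b eq))
... | false = refl

<⇒<ᵇ-true : (a b : ℕ) → a < b → (a <ᵇ b) ≡ true
<⇒<ᵇ-true a b a<b with a <ᵇ b in eq
... | true = refl
... | false = ⊥-elim (subst T eq (<⇒<ᵇ a<b))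

≤⇒<ᵇ-false : (a b : ℕ) → b ≤ a → (a <ᵇ b) ≡ false
≤⇒<ᵇ-false a b b≤a with a <ᵇ b in eq
... | true = ⊥-elim (<⇒≱ (<ᵇ⇒< a b (subst T (sym eq) _)) b≤a)
... | false = refl

≤⇒≤ᵇ-true : (a b : ℕ) → a ≤ b → (a ≤ᵇ b) ≡ true
≤⇒≤ᵇ-true zero b _ = refl
≤⇒≤ᵇ-true (suc a) b a<b = <⇒<ᵇ-true a b a<b

data Cmpᵇ (a b : ℕ) : Set where
  ltᵇ : a < b → (a <ᵇ b) ≡ true  → (b <ᵇ a) ≡ false → (a ≡ᵇ b) ≡ false → Cmpᵇ a b
  gtᵇ : b < a → (a <ᵇ b) ≡ false → (b <ᵇ a) ≡ true  → (a ≡ᵇ b) ≡ false → Cmpᵇ a b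
  eqᵇ : a ≡ b → (a <ᵇ b) ≡ false → (b <ᵇ a) ≡ false → (a ≡ᵇ b) ≡ true  → Cmpᵇ a b

cmpᵇ : (a b : ℕ) → Cmpᵇ a b
cmpᵇ a b with <-cmp a b
... | tri< a<b _ _ = ltᵇ a<b (<⇒<ᵇ-true a b a<b) (≤⇒<ᵇ-false b a (<⇒≤ a<b)) (≢⇒≡ᵇ-false a b (<⇒≢ a<b))
... | tri> _ _ b<a = gtᵇ b<a (≤⇒<ᵇ-false a b (<⇒≤ b<a)) (<⇒<ᵇ-true b a b<a) (≢⇒≡ᵇ-false a b (≢-sym (<⇒≢ b<a)))
... | tri≈ _ refl _ = eqᵇ refl (≤⇒<ᵇ-false a a ≤-refl) (≤⇒<ᵇ-false a a ≤-refl) (≡ᵇ-refl a)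

occ-++ : (a : ℕ) (xs ys : List ℕ) → occ a (xs ++ ys) ≡ occ a xs + occ a ys
occ-++ a [] ys = refl
occ-++ a (x ∷ xs) ys rewrite occ-++ a xs ys = sym (+-assoc (if a ≡ᵇ x then 1 else 0) (occ a xs) (occ a ys))

occ-∉ : (a : ℕ) (xs : List ℕ) → a ∉ xs → occ a xs ≡ 0
occ-∉ a [] _ = refl
occ-∉ a (x ∷ xs) a∉ rewrite ≢⇒≡ᵇ-false a x (a∉ ∘ here) = occ-∉ a xs (a∉ ∘ there)

occ-<-all : (a : ℕ) (xs : List ℕ) → All (_< a) xs → occ a xs ≡ 0
occ-<-all a xs xs<a = occ-∉ a xs (λ a∈ → <-irrefl refl (All.lookup xs<a a∈))

occ-replicate-self : (a j : ℕ) → occ a (replicate j a) ≡ j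
occ-replicate-self a zero = refl
occ-replicate-self a (suc j) rewrite ≡ᵇ-refl a = cong suc (occ-replicate-self a j)

occ-replicate-other : (a b j : ℕ) → b ≢ a → occ b (replicate j a) ≡ 0
occ-replicate-other a b zero _ = refl
occ-replicate-other a b (suc j) b≢a rewrite ≢⇒≡ᵇ-false b a b≢a = occ-replicate-other a b j b≢a

occ≤length : (a : ℕ) (xs : List ℕ) → occ a xs ≤ length xs
occ≤length a [] = z≤n
occ≤length a (x ∷ xs) with a ≡ᵇ x
... | true = s≤s (occ≤length a xs)
... | false = m≤n⇒m≤1+n (occ≤length a xs)

occ-upTo : (t n : ℕ) → t < n → occ t (upTo n) ≡ 1
occ-upTo t (suc n) t<1+n =
  trans (cong (occ t) (sym (applyUpTo-∷ʳ id n))) (trans (occ-++ t (upTo n) [ n ]) (last (cmpᵇ t n)))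
  where
  last : Cmpᵇ t n → occ t (upTo n) + ((if t ≡ᵇ n then 1 else 0) + 0) ≡ 1
  last (ltᵇ t<n _ _ t≢ᵇn) rewrite t≢ᵇn | occ-upTo t n t<n = refl
  last (gtᵇ n<t _ _ _) = ⊥-elim (<⇒≱ n<t (≤-pred t<1+n))
  last (eqᵇ refl _ _ t≡ᵇt) rewrite t≡ᵇt | occ-∉ t (upTo t) (λ t∈ → <-irrefl refl (∈-upTo⁻ t∈)) = refl

δ-∑< : (N y : ℕ) (h : ℕ → ℕ) → y < N → ∑< N (λ t → (if t ≡ᵇ y then 1 else 0) * h t) ≡ h y
δ-∑< (suc N) zero h _ = trans (cong₂ _+_ (+-identityʳ (h 0)) (∑<-0 N)) (+-identityʳ _)
δ-∑< (suc N) (suc y) h (s≤s y<N) = δ-∑< N y (h ∘ suc) y<N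

δ-∏< : (N y : ℕ) (f : ℕ → ℕ) → y < N → ∏< N (λ t → f t ^ (if t ≡ᵇ y then 1 else 0)) ≡ f y
δ-∏< (suc N) zero f _ = trans (cong₂ _*_ (*-identityʳ (f 0)) (∏<-1 N)) (*-identityʳ (f 0))
δ-∏< (suc N) (suc y) f (s≤s y<N) = trans (+-identityʳ _) (δ-∏< N y (f ∘ suc) y<N)

∑<-occ : (N : ℕ) (h : ℕ → ℕ) (xs : List ℕ) → All (_< N) xs → ∑< N (λ t → occ t xs * h t) ≡ ∑ h xs
∑<-occ N h [] _ = ∑<-0 N
∑<-occ N h (y ∷ xs) (y<N ∷ xs<N) = begin
  ∑< N (λ t → ((if t ≡ᵇ y then 1 else 0) + occ t xs) * h t)
    ≡⟨ ∑<-cong N (λ t _ → *-distribʳ-+ (h t) (if t ≡ᵇ y then 1 else 0) (occ t xs)) ⟩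
  ∑< N (λ t → (if t ≡ᵇ y then 1 else 0) * h t + occ t xs * h t)
    ≡⟨ ∑<-+ N _ _ ⟩
  ∑< N (λ t → (if t ≡ᵇ y then 1 else 0) * h t) + ∑< N (λ t → occ t xs * h t)
    ≡⟨ cong₂ _+_ (δ-∑< N y h y<N) (∑<-occ N h xs xs<N) ⟩
  h y + ∑ h xs ∎
  where open ≡-Reasoning

∏<-occ : (N : ℕ) (f : ℕ → ℕ) (xs : List ℕ) → All (_< N) xs → ∏< N (λ t → f t ^ occ t xs) ≡ product (map f xs)
∏<-occ N f [] _ = ∏<-1 N
∏<-occ N f (y ∷ xs) (y<N ∷ xs<N) = begin
  ∏< N (λ t → f t ^ ((if t ≡ᵇ y then 1 else 0) + occ t xs))
    ≡⟨ ∏<-cong N (λ t _ → ^-distribˡ-+-* (f t) (if t ≡ᵇ y then 1 else 0) (occ t xs)) ⟩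
  ∏< N (λ t → f t ^ (if t ≡ᵇ y then 1 else 0) * f t ^ occ t xs)
    ≡⟨ ∏<-* N _ _ ⟩
  ∏< N (λ t → f t ^ (if t ≡ᵇ y then 1 else 0)) * ∏< N (λ t → f t ^ occ t xs)
    ≡⟨ cong₂ _*_ (δ-∏< N y f y<N) (∏<-occ N f xs xs<N) ⟩
  f y * product (map f xs) ∎
  where open ≡-Reasoning

suc<⇒<∸1 : (t n : ℕ) → suc t < n → t < n ∸ 1
suc<⇒<∸1 t (suc n) (s≤s t<n) = t<n

∸1<self : (n : ℕ) → 1 ≤ n → n ∸ 1 < n
∸1<self (suc n) _ = ≤-refl


replicate-pred : {A : Set} (n : ℕ) (a : A) → 1 ≤ n → replicate n a ≡ a ∷ replicate (n ∸ 1) a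
replicate-pred (suc n) a _ = refl

upTo-pred : (n : ℕ) → 1 ≤ n → upTo n ≡ upTo (n ∸ 1) ++ [ n ∸ 1 ]
upTo-pred (suc n) _ = sym (applyUpTo-∷ʳ id n)

∈-oneTo⁻ : {n v : ℕ} → v ∈ oneTo n → 1 ≤ v × v ≤ n
∈-oneTo⁻ v∈ with ∈-map⁻ suc v∈
... | u , u∈ , refl = s≤s z≤n , ∈-upTo⁻ u∈

∈-oneTo⁺ : {n v : ℕ} → 1 ≤ v → v ≤ n → v ∈ oneTo n
∈-oneTo⁺ {n} {suc v} _ v≤n = ∈-map⁺ suc (∈-upTo⁺ v≤n)

∧-true⁻ : (b c : Bool) → (b ∧ c) ≡ true → b ≡ true × c ≡ true
∧-true⁻ true true _ = refl , refl

and-map⁻ : {A : Set} (f : A → Bool) (xs : List A) → and (map f xs) ≡ true → ∀ v → v ∈ xs → f v ≡ true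
and-map⁻ f (x ∷ xs) all v (here refl) = proj₁ (∧-true⁻ (f x) _ all)
and-map⁻ f (x ∷ xs) all v (there v∈) = and-map⁻ f xs (proj₂ (∧-true⁻ (f x) _ all)) v v∈

and-map⁺ : {A : Set} (f : A → Bool) (xs : List A) → (∀ v → v ∈ xs → f v ≡ true) → and (map f xs) ≡ true
and-map⁺ f [] _ = refl
and-map⁺ f (x ∷ xs) all rewrite all x (here refl) = and-map⁺ f xs (λ v v∈ → all v (there v∈))

module _ {A B : Set} where

  ∈-concatMap-intro : (g : A → List B) {xs : List A} {x : A} {z : B} → x ∈ xs → z ∈ g x → z ∈ concatMap g xs
  ∈-concatMap-intro g x∈ z∈ = ∈-concatMap⁺ g (lose x∈ z∈)

  ∈-concatMap-elim : (g : A → List B) {xs : List A} {z : B} → z ∈ concatMap g xs → ∃ λ x → x ∈ xs × z ∈ g x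
  ∈-concatMap-elim g {xs} z∈ = find (∈-concatMap⁻ g {xs = xs} z∈)

  Unique-map-inv : (f : A → B) (r : B → A) {xs : List A} → Unique xs → (∀ x → x ∈ xs → r (f x) ≡ x) →
                   Unique (map f xs)
  Unique-map-inv f r {[]} [] _ = []
  Unique-map-inv f r {x ∷ xs} (x∉ ∷ uxs) r∘f≗id =
    All.tabulate distinct ∷ Unique-map-inv f r uxs (λ y y∈ → r∘f≗id y (there y∈))
    where
    distinct : ∀ {z} → z ∈ map f xs → f x ≢ z
    distinct z∈ fx≡z with ∈-map⁻ f z∈
    ... | y , y∈ , refl =
        All.lookup x∉ y∈ (trans (sym (r∘f≗id x (here refl))) (trans (cong r fx≡z) (r∘f≗id y (there y∈))))

  Unique-concatMap-inv : (g : A → List B) (r : B → A) {xs : List A} → Unique xs →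
                         (∀ x → x ∈ xs → Unique (g x)) → (∀ x z → x ∈ xs → z ∈ g x → r z ≡ x) →
                         Unique (concatMap g xs)
  Unique-concatMap-inv g r {[]} [] _ _ = []
  Unique-concatMap-inv g r {x ∷ xs} (x∉ ∷ uxs) ug r-inv =
    Unique.++⁺ (ug x (here refl))
               (Unique-concatMap-inv g r uxs (λ y y∈ → ug y (there y∈)) (λ y z y∈ → r-inv y z (there y∈)))
               disjoint
    where
    disjoint : ∀ {z} → ¬ (z ∈ g x × z ∈ concatMap g xs)
    disjoint (z∈gx , z∈) with ∈-concatMap-elim g {xs = xs} z∈
    ... | y , y∈ , z∈gy = All.lookup x∉ y∈ (trans (sym (r-inv x _ (here refl) z∈gx)) (r-inv y _ (there y∈) z∈gy))

module _ {A : Set} (p : A → Bool) where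

  ∈-filterᵇ⁺ : {xs : List A} {w : A} → w ∈ xs → p w ≡ true → w ∈ filterᵇ p xs
  ∈-filterᵇ⁺ w∈ pw = ∈-filter⁺ (T? ∘ p) w∈ (subst T (sym pw) _)

  ∈-filterᵇ⁻ : {xs : List A} {w : A} → w ∈ filterᵇ p xs → w ∈ xs × p w ≡ true
  ∈-filterᵇ⁻ w∈ with ∈-filter⁻ (T? ∘ p) w∈
  ... | w∈xs , pw = w∈xs , T⇒≡true pw
    where
    T⇒≡true : {b : Bool} → T b → b ≡ true
    T⇒≡true {true} _ = refl

tuples : List ℕ → ℕ → List (List ℕ)
tuples xs zero = [] ∷ []
tuples xs (suc L) = concatMap (λ v → map (v ∷_) (tuples xs L)) xs

words≡tuples : (L n : ℕ) → words L n ≡ tuples (oneTo n) L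
words≡tuples zero n = refl
words≡tuples (suc L) n = cong (λ T → concatMap (λ v → map (v ∷_) T) (oneTo n)) (words≡tuples L n)

seqs≡tuples : (L b : ℕ) → seqs L b ≡ tuples (upTo (suc b)) L
seqs≡tuples zero b = refl
seqs≡tuples (suc L) b = cong (λ T → concatMap (λ v → map (v ∷_) T) (upTo (suc b))) (seqs≡tuples L b)

∈-tuples⁺ : (xs w : List ℕ) → All (_∈ xs) w → w ∈ tuples xs (length w)
∈-tuples⁺ xs [] [] = here refl
∈-tuples⁺ xs (v ∷ w) (v∈ ∷ w∈) =
    ∈-concatMap-intro (λ v → map (v ∷_) (tuples xs (length w))) v∈ (∈-map⁺ (v ∷_) (∈-tuples⁺ xs w w∈))

∈-tuples⁻ : (xs : List ℕ) (L : ℕ) {w : List ℕ} → w ∈ tuples xs L → length w ≡ L × All (_∈ xs) w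
∈-tuples⁻ xs zero (here refl) = refl , []
∈-tuples⁻ xs (suc L) w∈ with ∈-concatMap-elim (λ v → map (v ∷_) (tuples xs L)) {xs = xs} w∈
... | v , v∈ , vw∈ with ∈-map⁻ (v ∷_) vw∈
...   | w , w∈ , refl with ∈-tuples⁻ xs L w∈
...     | len , all = cong suc len , v∈ ∷ all

Unique-tuples : (xs : List ℕ) (L : ℕ) → Unique xs → Unique (tuples xs L)
Unique-tuples xs zero _ = [] ∷ []
Unique-tuples xs (suc L) uxs =
  Unique-concatMap-inv (λ v → map (v ∷_) (tuples xs L)) head uxs
    (λ v _ → Unique.map⁺ ∷-injectiveʳ (Unique-tuples xs L uxs))
    (λ v z _ z∈ → head-∷ v z∈)
  where
  head : List ℕ → ℕ
  head [] = 0
  head (v ∷ _) = v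
  head-∷ : ∀ v {z} → z ∈ map (v ∷_) (tuples xs L) → head z ≡ v
  head-∷ v z∈ with ∈-map⁻ (v ∷_) z∈
  ... | _ , _ , refl = refl


additive-insert : (f : List ℕ → ℕ) → (∀ xs ys → f (xs ++ ys) ≡ f xs + f ys) →
                  (bs σ : List ℕ) (i : ℕ) → f (take i σ ++ bs ++ drop i σ) ≡ f bs + f σ
additive-insert f f-++ bs σ i = begin
  f (take i σ ++ bs ++ drop i σ)        ≡⟨ f-++ (take i σ) _ ⟩
  f (take i σ) + f (bs ++ drop i σ)     ≡⟨ cong (f (take i σ) +_) (f-++ bs _) ⟩
  f (take i σ) + (f bs + f (drop i σ))  ≡⟨ +-left-comm (f (take i σ)) (f bs) _ ⟩
  f bs + (f (take i σ) + f (drop i σ))  ≡⟨ cong (f bs +_) (sym (f-++ (take i σ) _)) ⟩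
  f bs + f (take i σ ++ drop i σ)       ≡⟨ cong (λ w → f bs + f w) (take++drop≡id i σ) ⟩
  f bs + f σ                            ∎
  where open ≡-Reasoning

All-ʳ++ : {P : ℕ → Set} (xs ys : List ℕ) → All P xs → All P ys → All P (xs ʳ++ ys)
All-ʳ++ [] ys _ Pys = Pys
All-ʳ++ (x ∷ xs) ys (Px ∷ Pxs) Pys = All-ʳ++ xs (x ∷ ys) Pxs (Px ∷ Pys)

split-insert : (x : ℕ) (σ bs : List ℕ) (i : ℕ) → i ≤ length σ →
  ∃ λ us → ∃ λ l → ∃ λ h → ∃ λ w →
    (x ∷ σ ++ [ 0 ] ≡ us ++ l ∷ h ∷ w) × (x ∷ (take i σ ++ bs ++ drop i σ) ++ [ 0 ] ≡ us ++ l ∷ bs ++ h ∷ w)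
    × (length us ≡ i)
split-insert x [] bs zero _ = [] , x , 0 , [] , refl , cong (λ z → x ∷ z ++ [ 0 ]) (++-identityʳ bs) , refl
split-insert x (y ∷ σ) bs zero _ = [] , x , y , σ ++ [ 0 ] , refl , cong (x ∷_) (++-assoc bs (y ∷ σ) [ 0 ]) , refl
split-insert x (y ∷ σ) bs (suc i) (s≤s i≤) with split-insert y σ bs i i≤
... | us , l , h , w , e₁ , e₂ , len = x ∷ us , l , h , w , cong (x ∷_) e₁ , cong (x ∷_) e₂ , cong suc len

deleteAll : ℕ → List ℕ → List ℕ
deleteAll a [] = []
deleteAll a (x ∷ xs) = if x ≡ᵇ a then deleteAll a xs else x ∷ deleteAll a xs

deleteAll-below : (a : ℕ) (xs : List ℕ) → All (_< a) xs → deleteAll a xs ≡ xs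
deleteAll-below a [] _ = refl
deleteAll-below a (x ∷ xs) (x<a ∷ xs<a) rewrite ≢⇒≡ᵇ-false x a (<⇒≢ x<a) = cong (x ∷_) (deleteAll-below a xs xs<a)

deleteAll-++ : (a : ℕ) (xs ys : List ℕ) → deleteAll a (xs ++ ys) ≡ deleteAll a xs ++ deleteAll a ys
deleteAll-++ a [] ys = refl
deleteAll-++ a (x ∷ xs) ys with x ≡ᵇ a
... | true = deleteAll-++ a xs ys
... | false = cong (x ∷_) (deleteAll-++ a xs ys)

deleteAll-replicate : (a j : ℕ) → deleteAll a (replicate j a) ≡ []
deleteAll-replicate a zero = refl
deleteAll-replicate a (suc j) rewrite ≡ᵇ-refl a = deleteAll-replicate a j

firstIndex : ℕ → List ℕ → ℕ
firstIndex a [] = 0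
firstIndex a (x ∷ xs) = if x ≡ᵇ a then 0 else suc (firstIndex a xs)

firstIndex-below : (a : ℕ) (xs ys : List ℕ) → All (_< a) xs → firstIndex a (xs ++ a ∷ ys) ≡ length xs
firstIndex-below a [] ys _ rewrite ≡ᵇ-refl a = refl
firstIndex-below a (x ∷ xs) ys (x<a ∷ xs<a) rewrite ≢⇒≡ᵇ-false x a (<⇒≢ x<a) =
    cong suc (firstIndex-below a xs ys xs<a)

-- The grammar x_i → x_1 x_2 ⋯ x_N

raiseExcept : ℕ → (ℕ → ℕ) → ℕ → ℕ
raiseExcept t c s = if s ≡ᵇ t then c s else suc (c s)

-- An exponent vector c : ℕ → ℕ stands for the monomial x^c = x_1^{c 0} ⋯ x_N^{c (N-1)}, and
-- D r c for Dʳ(x^c), where D is the derivation of the grammar x_i → x_1 x_2 ⋯ x_N: the term of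
-- D(x^c) coming from x_{t+1} is c t times the monomial with every exponent except the t-th raised.
module Grammar (x : ℕ → ℕ) (N : ℕ) where

  mono : (ℕ → ℕ) → ℕ
  mono c = ∏< N (λ t → x (suc t) ^ c t)

  D : ℕ → (ℕ → ℕ) → ℕ
  D zero c = mono c
  D (suc r) c = ∑< N (λ t → c t * D r (raiseExcept t c))

  D-cong : (r : ℕ) {c c′ : ℕ → ℕ} → (∀ t → t < N → c t ≡ c′ t) → D r c ≡ D r c′
  D-cong zero c≗c′ = ∏<-cong N (λ t t<N → cong (x (suc t) ^_) (c≗c′ t t<N))
  D-cong (suc r) {c} {c′} c≗c′ =
    ∑<-cong N (λ t t<N → cong₂ _*_ (c≗c′ t t<N) (D-cong r (λ s s<N → raise≗ t s s<N)))
    where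
    raise≗ : ∀ t s → s < N → raiseExcept t c s ≡ raiseExcept t c′ s
    raise≗ t s s<N with s ≡ᵇ t
    ... | true = c≗c′ s s<N
    ... | false = cong suc (c≗c′ s s<N)

  mono-+ : (c c′ : ℕ → ℕ) → mono (λ t → c t + c′ t) ≡ mono c * mono c′
  mono-+ c c′ = trans (∏<-cong N (λ t _ → ^-distribˡ-+-* (x (suc t)) (c t) (c′ t))) (∏<-* N _ _)

  mono-0 : mono (λ _ → 0) ≡ 1
  mono-0 = ∏<-1 N


-- k-Stirling permutations

-- Gaps of a k-Stirling permutation σ are the indices 0 … kn of its padded word; the gap between
-- σ_i and σ_{i+1} has type k (ascent), k ∸ 1 (descent) or j ∸ 1 (j-plateau), so that weight k x σ
-- is the monomial x^c with c t the number of gaps of type t. The first argument of gapType and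
-- gapTypesFrom holds the letters already read, σ_{i-1} … σ_0.
module GapTypes (k : ℕ) where

  gapType : List ℕ → ℕ → ℕ → ℕ
  gapType pre a b = if a <ᵇ b then k else (if b <ᵇ a then k ∸ 1 else occ a pre)

  gapTypesFrom : List ℕ → List ℕ → List ℕ
  gapTypesFrom pre (a ∷ b ∷ w) = gapType pre a b ∷ gapTypesFrom (a ∷ pre) (b ∷ w)
  gapTypesFrom pre _ = []

  gapTypes : List ℕ → List ℕ
  gapTypes σ = gapTypesFrom [] (pad σ)

  gapTypeCount : List ℕ → ℕ → ℕ
  gapTypeCount σ t = occ t (gapTypes σ)

  insertBlock : ℕ → List ℕ → ℕ → List ℕ
  insertBlock a σ i = take i σ ++ replicate k a ++ drop i σ

  gapTypesFrom-++ : ∀ pre xs y ys →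
    gapTypesFrom pre (xs ++ y ∷ ys) ≡ gapTypesFrom pre (xs ++ [ y ]) ++ gapTypesFrom (xs ʳ++ pre) (y ∷ ys)
  gapTypesFrom-++ pre [] y ys = refl
  gapTypesFrom-++ pre (x ∷ []) y ys = refl
  gapTypesFrom-++ pre (x ∷ x′ ∷ xs) y ys = cong (gapType pre x x′ ∷_) (gapTypesFrom-++ (x ∷ pre) (x′ ∷ xs) y ys)

  length-gapTypesFrom : ∀ pre xs y → length (gapTypesFrom pre (xs ++ [ y ])) ≡ length xs
  length-gapTypesFrom pre [] y = refl
  length-gapTypesFrom pre (x ∷ []) y = refl
  length-gapTypesFrom pre (x ∷ x′ ∷ xs) y = cong suc (length-gapTypesFrom (x ∷ pre) (x′ ∷ xs) y)

  gapTypesFrom-occ-cong : ∀ Q P P′ w → (∀ b → b ∈ w → occ b P ≡ occ b P′) →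
                          gapTypesFrom (Q ++ P) w ≡ gapTypesFrom (Q ++ P′) w
  gapTypesFrom-occ-cong Q P P′ [] _ = refl
  gapTypesFrom-occ-cong Q P P′ (a ∷ []) _ = refl
  gapTypesFrom-occ-cong Q P P′ (a ∷ b ∷ w) P≈P′ =
    cong₂ _∷_ (cong (λ o → if a <ᵇ b then k else (if b <ᵇ a then k ∸ 1 else o)) occ-a)
              (gapTypesFrom-occ-cong (a ∷ Q) P P′ (b ∷ w) (λ c c∈ → P≈P′ c (there c∈)))
    where
    occ-a : occ a (Q ++ P) ≡ occ a (Q ++ P′)
    occ-a = trans (occ-++ a Q P) (trans (cong (occ a Q +_) (P≈P′ a (here refl))) (sym (occ-++ a Q P′)))

  gapTypesFrom-run : ∀ a h w j P → h < a →
    gapTypesFrom P (a ∷ replicate j a ++ h ∷ w)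
      ≡ applyUpTo (occ a P +_) j ++ (k ∸ 1) ∷ gapTypesFrom (replicate (suc j) a ++ P) (h ∷ w)
  gapTypesFrom-run a h w zero P h<a rewrite ≤⇒<ᵇ-false a h (<⇒≤ h<a) | <⇒<ᵇ-true h a h<a = refl
  gapTypesFrom-run a h w (suc j) P h<a rewrite ≤⇒<ᵇ-false a a ≤-refl =
    cong₂ _∷_ (sym (+-identityʳ _)) (trans (gapTypesFrom-run a h w j (a ∷ P) h<a) shift)
    where
    replicate-∷ : ∀ j → replicate j a ++ a ∷ P ≡ a ∷ replicate j a ++ P
    replicate-∷ zero = refl
    replicate-∷ (suc j) = cong (a ∷_) (replicate-∷ j)
    applyUpTo-cong : ∀ {f g : ℕ → ℕ} j → (∀ s → f s ≡ g s) → applyUpTo f j ≡ applyUpTo g j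
    applyUpTo-cong zero _ = refl
    applyUpTo-cong (suc j) f≗g = cong₂ _∷_ (f≗g 0) (applyUpTo-cong j (f≗g ∘ suc))
    shift : applyUpTo (occ a (a ∷ P) +_) j ++ (k ∸ 1) ∷ gapTypesFrom (replicate (suc j) a ++ a ∷ P) (h ∷ w)
          ≡ applyUpTo (λ s → occ a P + suc s) j ++ (k ∸ 1) ∷ gapTypesFrom (a ∷ a ∷ replicate j a ++ P) (h ∷ w)
    shift rewrite ≡ᵇ-refl a | replicate-∷ j =
      cong (_++ (k ∸ 1) ∷ gapTypesFrom (a ∷ a ∷ replicate j a ++ P) (h ∷ w))
           (applyUpTo-cong j (λ s → sym (+-suc (occ a P) s)))

  -- The block a^k between letters l, h < a, with a not read before, contributes the gaps
  -- l < a (type k), the plateaus a = a (types 0 … k ∸ 2) and a > h (type k ∸ 1).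
  gapTypesFrom-block : ∀ a l h w P → 1 ≤ k → l < a → All (_< a) (h ∷ w) → occ a P ≡ 0 →
    gapTypesFrom P (l ∷ replicate k a ++ h ∷ w) ≡ (k ∷ upTo k) ++ gapTypesFrom (l ∷ P) (h ∷ w)
  gapTypesFrom-block a l h w P k≥1 l<a hw<a a∉P
    rewrite replicate-pred k a k≥1 | upTo-pred k k≥1 | <⇒<ᵇ-true l a l<a = cong (k ∷_) (begin
    gapTypesFrom (l ∷ P) (a ∷ replicate (k ∸ 1) a ++ h ∷ w)
      ≡⟨ gapTypesFrom-run a h w (k ∸ 1) (l ∷ P) (All.head hw<a) ⟩
    applyUpTo (occ a (l ∷ P) +_) (k ∸ 1) ++ (k ∸ 1) ∷ gapTypesFrom (replicate (suc (k ∸ 1)) a ++ l ∷ P) (h ∷ w)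
      ≡⟨ cong₂ (λ u v → applyUpTo u (k ∸ 1) ++ (k ∸ 1) ∷ v) (cong _+_ occ-a) drop-run ⟩
    upTo (k ∸ 1) ++ (k ∸ 1) ∷ gapTypesFrom (l ∷ P) (h ∷ w)
      ≡⟨ sym (++-assoc (upTo (k ∸ 1)) [ k ∸ 1 ] _) ⟩
    (upTo (k ∸ 1) ++ [ k ∸ 1 ]) ++ gapTypesFrom (l ∷ P) (h ∷ w) ∎)
    where
    open ≡-Reasoning
    occ-a : occ a (l ∷ P) ≡ 0
    occ-a rewrite ≢⇒≡ᵇ-false a l (≢-sym (<⇒≢ l<a)) = a∉P
    drop-run : gapTypesFrom (replicate (suc (k ∸ 1)) a ++ l ∷ P) (h ∷ w) ≡ gapTypesFrom (l ∷ P) (h ∷ w)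
    drop-run = gapTypesFrom-occ-cong [] (replicate (suc (k ∸ 1)) a ++ l ∷ P) (l ∷ P) (h ∷ w)
      (λ b b∈ → trans (occ-++ b (replicate (suc (k ∸ 1)) a) (l ∷ P))
                      (cong (_+ occ b (l ∷ P)) (occ-replicate-other a b (suc (k ∸ 1)) (<⇒≢ (All.lookup hw<a b∈)))))

  gapTypes-insertBlock : ∀ a σ i → 1 ≤ k → 0 < a → All (_< a) σ → i ≤ length σ →
    ∃ λ A → ∃ λ g → ∃ λ B →
      (gapTypes σ ≡ A ++ g ∷ B) × (gapTypes (insertBlock a σ i) ≡ A ++ (k ∷ upTo k) ++ B) × (length A ≡ i)
  gapTypes-insertBlock a σ i k≥1 a>0 σ<a i≤ with split-insert 0 σ (replicate k a) i i≤
  ... | us , l , h , w , e₁ , e₂ , len =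
    gapTypesFrom [] (us ++ [ l ]) , gapType (us ʳ++ []) l h , gapTypesFrom (l ∷ us ʳ++ []) (h ∷ w) ,
    trans (cong (gapTypesFrom []) e₁) (gapTypesFrom-++ [] us l (h ∷ w)) ,
    trans (cong (gapTypesFrom []) e₂) (trans (gapTypesFrom-++ [] us l (replicate k a ++ h ∷ w))
      (cong (gapTypesFrom [] (us ++ [ l ]) ++_)
            (gapTypesFrom-block a l h w (us ʳ++ []) k≥1 (All.head luhw<a) (All.tail luhw<a) occ-us))) ,
    trans (length-gapTypesFrom [] us l) len
    where
    pad<a : All (_< a) (us ++ l ∷ h ∷ w)
    pad<a = subst (All (_< a)) e₁ (a>0 ∷ All.++⁺ σ<a (a>0 ∷ []))
    luhw<a : All (_< a) (l ∷ h ∷ w)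
    luhw<a = All.++⁻ʳ us pad<a
    occ-us : occ a (us ʳ++ []) ≡ 0
    occ-us = occ-<-all a (us ʳ++ []) (All-ʳ++ us [] (All.++⁻ˡ us pad<a) [])

  occ-block : (t : ℕ) → t < suc k → occ t (k ∷ upTo k) ≡ 1
  occ-block t t≤k with cmpᵇ t k
  ... | ltᵇ t<k _ _ t≢ᵇk rewrite t≢ᵇk = occ-upTo t k t<k
  ... | gtᵇ k<t _ _ _ = ⊥-elim (<⇒≱ k<t (≤-pred t≤k))
  ... | eqᵇ refl _ _ t≡ᵇt rewrite t≡ᵇt = cong suc (occ-∉ t (upTo t) (λ t∈ → <-irrefl refl (∈-upTo⁻ t∈)))

  occ-replace-block : (A B : List ℕ) (g t : ℕ) → t < suc k →
    occ t (A ++ (k ∷ upTo k) ++ B) ≡ raiseExcept g (λ s → occ s (A ++ g ∷ B)) t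
  occ-replace-block A B g t t≤k
    rewrite occ-++ t A ((k ∷ upTo k) ++ B) | occ-++ t (k ∷ upTo k) B | occ-block t t≤k | occ-++ t A (g ∷ B)
    with t ≡ᵇ g
  ... | true = refl
  ... | false = +-suc (occ t A) (occ t B)

  -- Inserting the block into gap i replaces its type g by one gap of each type 0 … k: the exponent
  -- change of the g-th term of D.
  gapTypeCount-insertBlock : ∀ a σ i t → 1 ≤ k → 0 < a → All (_< a) σ → i ≤ length σ → t < suc k →
    gapTypeCount (insertBlock a σ i) t ≡ raiseExcept (nth (gapTypes σ) i) (gapTypeCount σ) t
  gapTypeCount-insertBlock a σ i t k≥1 a>0 σ<a i≤ t≤k with gapTypes-insertBlock a σ i k≥1 a>0 σ<a i≤
  ... | A , g , B , e₁ , e₂ , refl = begin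
    occ t (gapTypes (insertBlock a σ (length A))) ≡⟨ cong (occ t) e₂ ⟩
    occ t (A ++ (k ∷ upTo k) ++ B)                 ≡⟨ occ-replace-block A B g t t≤k ⟩
    raiseExcept g (λ s → occ s (A ++ g ∷ B)) t
      ≡⟨ cong₂ (λ u v → raiseExcept u (λ s → occ s v) t)
          (sym (trans (cong (λ z → nth z (length A)) e₁) (nth-middle A))) (sym e₁) ⟩
    raiseExcept (nth (gapTypes σ) (length A)) (gapTypeCount σ) t ∎
    where
    open ≡-Reasoning
    nth-middle : (A : List ℕ) → nth (A ++ g ∷ B) (length A) ≡ g
    nth-middle [] = refl
    nth-middle (_ ∷ A) = nth-middle A

  -- In a k-Stirling permutation every letter occurs k times, so a j-plateau has j ≤ k ∸ 1 and its
  -- type j ∸ 1 differs from the descent type k ∸ 1.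
  ProperPlateaus : List ℕ → List ℕ → Set
  ProperPlateaus pre (a ∷ b ∷ w) = (a ≡ b → 2 + occ a pre ≤ k) × ProperPlateaus (a ∷ pre) (b ∷ w)
  ProperPlateaus pre _ = ⊤

  platP≡occ : ∀ pre w t → suc t < k → platP (suc t) pre w ≡ occ t (gapTypesFrom pre w)
  platP≡occ pre [] t _ = refl
  platP≡occ pre (a ∷ []) t _ = refl
  platP≡occ pre (a ∷ b ∷ w) t t+1<k with cmpᵇ a b | platP≡occ (a ∷ pre) (b ∷ w) t t+1<k
  ... | ltᵇ _ a<ᵇb _ a≢ᵇb | ih rewrite a<ᵇb | a≢ᵇb | ≢⇒≡ᵇ-false t k (<⇒≢ (<-trans (n<1+n t) t+1<k)) = ih
  ... | gtᵇ _ a<ᵇb b<ᵇa a≢ᵇb | ih rewrite a<ᵇb | b<ᵇa | a≢ᵇb | ≢⇒≡ᵇ-false t (k ∸ 1) (<⇒≢ (suc<⇒<∸1 t k t+1<k)) = ih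
  ... | eqᵇ refl a<ᵇb _ a≡ᵇb | ih rewrite a<ᵇb | a≡ᵇb | ≡ᵇ-sym (occ a pre) t =
      cong ((if t ≡ᵇ occ a pre then 1 else 0) +_) ih

  desP≡occ : 1 ≤ k → ∀ pre w → ProperPlateaus pre w → desP w ≡ occ (k ∸ 1) (gapTypesFrom pre w)
  desP≡occ k≥1 pre [] _ = refl
  desP≡occ k≥1 pre (a ∷ []) _ = refl
  desP≡occ k≥1 pre (a ∷ b ∷ w) (proper , propers) with cmpᵇ a b | desP≡occ k≥1 (a ∷ pre) (b ∷ w) propers
  ... | ltᵇ _ a<ᵇb b<ᵇa _ | ih rewrite a<ᵇb | b<ᵇa | ≢⇒≡ᵇ-false (k ∸ 1) k (<⇒≢ (∸1<self k k≥1)) = ih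
  ... | gtᵇ _ a<ᵇb b<ᵇa _ | ih rewrite a<ᵇb | b<ᵇa | ≡ᵇ-refl (k ∸ 1) = cong suc ih
  ... | eqᵇ refl a<ᵇb _ _ | ih rewrite a<ᵇb | ≢⇒≡ᵇ-false (k ∸ 1) (occ a pre)
      (≢-sym (<⇒≢ (∸-monoˡ-≤ 1 (proper refl)))) = ih

  ascP≡occ : 1 ≤ k → ∀ pre w → ProperPlateaus pre w → ascP w ≡ occ k (gapTypesFrom pre w)
  ascP≡occ k≥1 pre [] _ = refl
  ascP≡occ k≥1 pre (a ∷ []) _ = refl
  ascP≡occ k≥1 pre (a ∷ b ∷ w) (proper , propers) with cmpᵇ a b | ascP≡occ k≥1 (a ∷ pre) (b ∷ w) propers
  ... | ltᵇ _ a<ᵇb _ _ | ih rewrite a<ᵇb | ≡ᵇ-refl k = cong suc ih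
  ... | gtᵇ _ a<ᵇb b<ᵇa _ | ih rewrite a<ᵇb | b<ᵇa | ≢⇒≡ᵇ-false k (k ∸ 1) (≢-sym (<⇒≢ (∸1<self k k≥1))) = ih
  ... | eqᵇ refl a<ᵇb _ _ | ih rewrite a<ᵇb | ≢⇒≡ᵇ-false k (occ a pre)
      (≢-sym (<⇒≢ (≤-trans (n≤1+n _) (proper refl)))) = ih

  properPlateaus : ∀ pre q → All (1 ≤_) q → (∀ a → 1 ≤ a → occ a pre + occ a (q ++ [ 0 ]) ≤ k) →
                   ProperPlateaus pre (q ++ [ 0 ])
  properPlateaus pre [] _ _ = tt
  properPlateaus pre (s ∷ []) (s≥1 ∷ _) _ = (λ { refl → ⊥-elim (1+n≰n s≥1) }) , tt
  properPlateaus pre (s ∷ s′ ∷ q) (s≥1 ∷ q≥1) bound = plateau , properPlateaus (s ∷ pre) (s′ ∷ q) q≥1 bound′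
    where
    plateau : s ≡ s′ → 2 + occ s pre ≤ k
    plateau refl = ≤-trans two-more (bound s s≥1)
      where
      two-more : 2 + occ s pre ≤ occ s pre + occ s (s ∷ s ∷ q ++ [ 0 ])
      two-more rewrite ≡ᵇ-refl s =
          ≤-trans (≤-reflexive (+-comm 2 (occ s pre))) (+-monoʳ-≤ (occ s pre) (s≤s (s≤s z≤n)))
    bound′ : ∀ a → 1 ≤ a → occ a (s ∷ pre) + occ a (s′ ∷ q ++ [ 0 ]) ≤ k
    bound′ a a≥1 =
      ≤-trans (≤-reflexive (trans (+-assoc i (occ a pre) rest) (+-left-comm i (occ a pre) rest))) (bound a a≥1)
      where
      i = if a ≡ᵇ s then 1 else 0
      rest = occ a (s′ ∷ q ++ [ 0 ])

  properPlateaus-pad : (s : ℕ) (σ : List ℕ) → All (1 ≤_) (s ∷ σ) → (∀ a → 1 ≤ a → occ a (s ∷ σ) ≤ k) →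
                       ProperPlateaus [] (pad (s ∷ σ))
  properPlateaus-pad s σ σ≥1@(s≥1 ∷ _) bound =
    (λ { refl → ⊥-elim (1+n≰n s≥1) }) , properPlateaus (0 ∷ []) (s ∷ σ) σ≥1 bound′
    where
    bound′ : ∀ a → 1 ≤ a → occ a (0 ∷ []) + occ a ((s ∷ σ) ++ [ 0 ]) ≤ k
    bound′ (suc a) a≥1 rewrite occ-++ (suc a) (s ∷ σ) [ 0 ] | +-identityʳ (occ (suc a) (s ∷ σ)) = bound (suc a) a≥1

  module _ (x : ℕ → ℕ) where
    open Grammar x (suc k)

    weight≡mono : 1 ≤ k → (σ : List ℕ) → ProperPlateaus [] (pad σ) → weight k x σ ≡ mono (gapTypeCount σ)
    weight≡mono k≥1 σ proper = begin
      product (map (λ j → x j ^ plat j σ) (oneTo (k ∸ 1))) * (x k ^ des σ) * (x (suc k) ^ asc σ)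
        ≡⟨ cong₂ (λ u v → u * (x k ^ v) * (x (suc k) ^ asc σ)) plateaus (desP≡occ k≥1 [] (pad σ) proper) ⟩
      ∏< (k ∸ 1) f * (x k ^ gapTypeCount σ (k ∸ 1)) * (x (suc k) ^ asc σ)
        ≡⟨ cong₂ (λ u v → ∏< (k ∸ 1) f * (x u ^ gapTypeCount σ (k ∸ 1)) * (x (suc k) ^ v))
                 (sym k-1+1) (ascP≡occ k≥1 [] (pad σ) proper) ⟩
      ∏< (k ∸ 1) f * f (k ∸ 1) * f k
        ≡⟨ cong (_* f k) (sym (trans (cong (λ z → ∏< z f) (sym k-1+1)) (∏<-suc (k ∸ 1) f))) ⟩
      ∏< k f * f k
        ≡⟨ sym (∏<-suc k f) ⟩
      mono (gapTypeCount σ) ∎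
      where
      open ≡-Reasoning
      f : ℕ → ℕ
      f t = x (suc t) ^ gapTypeCount σ t
      k-1+1 : suc (k ∸ 1) ≡ k
      k-1+1 = trans (+-comm 1 (k ∸ 1)) (m∸n+n≡m k≥1)
      plateaus : product (map (λ j → x j ^ plat j σ) (oneTo (k ∸ 1))) ≡ ∏< (k ∸ 1) f
      plateaus = trans (cong product (trans (sym (map-∘ (upTo (k ∸ 1)))) (map-upTo _ (k ∸ 1))))
                       (∏<-cong (k ∸ 1)
                           (λ t t< → cong (x (suc t) ^_)
                               (platP≡occ [] (pad σ) t (≤-trans (s≤s t<) (≤-reflexive k-1+1)))))

stirlingHead-skip : (y a : ℕ) → y < a → (us vs : List ℕ) (j : ℕ) (seen : Bool) →
                    stirlingHead y (us ++ replicate j a ++ vs) seen ≡ stirlingHead y (us ++ vs) seen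
stirlingHead-skip y a y<a [] vs zero seen = refl
stirlingHead-skip y a y<a [] vs (suc j) seen
  rewrite ≢⇒≡ᵇ-false y a (<⇒≢ y<a) | ≤⇒<ᵇ-false a y (<⇒≤ y<a) with seen
... | true = stirlingHead-skip y a y<a [] vs j true
... | false = stirlingHead-skip y a y<a [] vs j false
stirlingHead-skip y a y<a (u ∷ us) vs j seen =
  cong (not (seen ∧ (y ≡ᵇ u)) ∧_) (stirlingHead-skip y a y<a us vs j (seen ∨ (u <ᵇ y)))

stirlingHead-below : (a : ℕ) (zs : List ℕ) → All (_< a) zs → (seen : Bool) → stirlingHead a zs seen ≡ true
stirlingHead-below a [] _ seen = refl
stirlingHead-below a (z ∷ zs) (z<a ∷ zs<a) seen rewrite ≢⇒≡ᵇ-false a z (≢-sym (<⇒≢ z<a)) with seen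
... | true = stirlingHead-below a zs zs<a _
... | false = stirlingHead-below a zs zs<a _

stirlingHead-run : (a j : ℕ) (zs : List ℕ) → All (_< a) zs → stirlingHead a (replicate j a ++ zs) false ≡ true
stirlingHead-run a zero zs zs<a = stirlingHead-below a zs zs<a false
stirlingHead-run a (suc j) zs zs<a rewrite ≤⇒<ᵇ-false a a ≤-refl = stirlingHead-run a j zs zs<a

stirling-insertMax : (a : ℕ) (ys zs : List ℕ) (j : ℕ) → All (_< a) ys → All (_< a) zs →
                     stirling (ys ++ replicate j a ++ zs) ≡ stirling (ys ++ zs)
stirling-insertMax a [] zs zero _ _ = refl
stirling-insertMax a [] zs (suc j) _ zs<a rewrite stirlingHead-run a j zs zs<a = stirling-insertMax a [] zs j [] zs<a
stirling-insertMax a (y ∷ ys) zs j (y<a ∷ ys<a) zs<a =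
  cong₂ _∧_ (stirlingHead-skip y a y<a ys zs j false) (stirling-insertMax a ys zs j ys<a zs<a)

stirlingHead-seen : (a : ℕ) (xs : List ℕ) → stirlingHead a xs true ≡ true → a ∉ xs
stirlingHead-seen a (x ∷ xs) sh (here refl) rewrite ≡ᵇ-refl a with sh
... | ()
stirlingHead-seen a (x ∷ xs) sh (there a∈) = stirlingHead-seen a xs (proj₂ (∧-true⁻ _ _ sh)) a∈

stirlingHead-max : (a : ℕ) (w : List ℕ) → stirlingHead a w false ≡ true → All (_≤ a) w →
                   ∃ λ j → ∃ λ zs → w ≡ replicate j a ++ zs × All (_< a) zs
stirlingHead-max a [] _ _ = 0 , [] , refl , []
stirlingHead-max a (b ∷ w) sh (b≤a ∷ w≤a) with cmpᵇ b a
... | ltᵇ b<a b<ᵇa _ _ rewrite b<ᵇa = 0 , b ∷ w , refl , b<a ∷ All.tabulate below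
  where
  below : ∀ {z} → z ∈ w → z < a
  below z∈ = ≤∧≢⇒< (All.lookup w≤a z∈) (λ { refl → stirlingHead-seen a w (proj₂ (∧-true⁻ _ _ sh)) z∈ })
... | gtᵇ a<b _ _ _ = ⊥-elim (<⇒≱ a<b b≤a)
... | eqᵇ refl b<ᵇa _ _ rewrite b<ᵇa with stirlingHead-max a w (proj₂ (∧-true⁻ _ _ sh)) w≤a
...   | j , zs , refl , zs<a = suc j , zs , refl , zs<a

stirling-maxBlock : (a k : ℕ) (τ : List ℕ) → 1 ≤ k → stirling τ ≡ true → All (_≤ a) τ → occ a τ ≡ k →
  ∃ λ ys → ∃ λ zs → τ ≡ ys ++ replicate k a ++ zs × All (_< a) ys × All (_< a) zs
stirling-maxBlock a (suc k) [] _ _ _ ()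
stirling-maxBlock a k (x ∷ τ) k≥1 st (x≤a ∷ τ≤a) occ≡k with x ≟ a
... | yes refl with stirlingHead-max a τ (proj₁ (∧-true⁻ _ _ st)) τ≤a
...   | j , zs , refl , zs<a = [] , zs , cong (λ i → replicate i a ++ zs) 1+j≡k , [] , zs<a
  where
  1+j≡k : suc j ≡ k
  1+j≡k = trans (sym (begin
    occ a (a ∷ replicate j a ++ zs)      ≡⟨ cong (_+ occ a (replicate j a ++ zs))
        (cong (λ b → if b then 1 else 0) (≡ᵇ-refl a)) ⟩
    suc (occ a (replicate j a ++ zs))    ≡⟨ cong suc (occ-++ a (replicate j a) zs) ⟩
    suc (occ a (replicate j a) + occ a zs)
        ≡⟨ cong₂ (λ u v → suc (u + v)) (occ-replicate-self a j) (occ-<-all a zs zs<a) ⟩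
    suc (j + 0)                          ≡⟨ cong suc (+-identityʳ j) ⟩
    suc j                                ∎)) occ≡k
    where open ≡-Reasoning
stirling-maxBlock a k (x ∷ τ) k≥1 st (x≤a ∷ τ≤a) occ≡k | no x≢a
  rewrite ≢⇒≡ᵇ-false a x (≢-sym x≢a)
  with stirling-maxBlock a k τ k≥1 (proj₂ (∧-true⁻ _ _ st)) τ≤a occ≡k
... | ys , zs , refl , ys<a , zs<a = x ∷ ys , zs , refl , ≤∧≢⇒< x≤a x≢a ∷ ys<a , zs<a

record IsStirlingPerm (k n : ℕ) (τ : List ℕ) : Set where
  field
    length≡    : length τ ≡ k * n
    inRange    : All (λ v → 1 ≤ v × v ≤ n) τ
    occ≡       : ∀ v → 1 ≤ v → v ≤ n → occ v τ ≡ k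
    isStirling : stirling τ ≡ true

module _ (k : ℕ) where
  open GapTypes k

  ∈-Q⁻ : (n : ℕ) {τ : List ℕ} → τ ∈ Q n k → IsStirlingPerm k n τ
  ∈-Q⁻ n {τ} τ∈ with ∈-filterᵇ⁻ (λ w → multisetOK n k w ∧ stirling w) τ∈
  ... | τ∈words , ok with ∈-tuples⁻ (oneTo n) (k * n) (subst (τ ∈_) (words≡tuples (k * n) n) τ∈words)
  ...   | len , letters = record
    { length≡ = len
    ; inRange = All.map ∈-oneTo⁻ letters
    ; occ≡ = λ v v≥1 v≤n →
        ≡ᵇ-true⇒≡ _ _ (and-map⁻ (λ v → occ v τ ≡ᵇ k) (oneTo n) (proj₁ (∧-true⁻ _ _ ok)) v (∈-oneTo⁺ v≥1 v≤n))
    ; isStirling = proj₂ (∧-true⁻ _ _ ok)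
    }

  ∈-Q⁺ : (n : ℕ) {τ : List ℕ} → IsStirlingPerm k n τ → τ ∈ Q n k
  ∈-Q⁺ n {τ} τ-perm = ∈-filterᵇ⁺ (λ w → multisetOK n k w ∧ stirling w) τ∈words (cong₂ _∧_ multiset isStirling)
    where
    open IsStirlingPerm τ-perm
    τ∈words : τ ∈ words (k * n) n
    τ∈words = subst (τ ∈_) (sym (words≡tuples (k * n) n))
                (subst (λ L → τ ∈ tuples (oneTo n) L) length≡
                  (∈-tuples⁺ (oneTo n) τ (All.map (λ { (v≥1 , v≤n) → ∈-oneTo⁺ v≥1 v≤n }) inRange)))
    multiset : multisetOK n k τ ≡ true
    multiset = and-map⁺ (λ v → occ v τ ≡ᵇ k) (oneTo n)
      (λ v v∈ → let v≥1 , v≤n = ∈-oneTo⁻ v∈ in subst (λ o → (o ≡ᵇ k) ≡ true) (sym (occ≡ v v≥1 v≤n)) (≡ᵇ-refl k))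

  Unique-Q : (n : ℕ) → Unique (Q n k)
  Unique-Q n = Unique.filter⁺ _ (subst Unique (sym (words≡tuples (k * n) n))
                                      (Unique-tuples (oneTo n) (k * n) (Unique.map⁺ suc-injective (Unique.upTo⁺ n))))

module _ (k : ℕ) where
  open GapTypes k

  length-insertBlock : (a : ℕ) (σ : List ℕ) (i : ℕ) → length (insertBlock a σ i) ≡ k + length σ
  length-insertBlock a σ i =
    trans (additive-insert length (λ xs ys → length-++ xs) (replicate k a) σ i)
          (cong (_+ length σ) (length-replicate k))

  occ-insertBlock : (a : ℕ) (σ : List ℕ) (i v : ℕ) → occ v (insertBlock a σ i) ≡ occ v (replicate k a) + occ v σ
  occ-insertBlock a σ i v = additive-insert (occ v) (occ-++ v) (replicate k a) σ i

  letters<suc : (m : ℕ) {σ : List ℕ} → IsStirlingPerm k m σ → All (_< suc m) σ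
  letters<suc m σ-perm = All.map (s≤s ∘ proj₂) (IsStirlingPerm.inRange σ-perm)

  insertBlock-isStirlingPerm : (m : ℕ) {σ : List ℕ} (i : ℕ) → IsStirlingPerm k m σ →
                               IsStirlingPerm k (suc m) (insertBlock (suc m) σ i)
  insertBlock-isStirlingPerm m {σ} i σ-perm = record
    { length≡ = trans (length-insertBlock a σ i) (trans (cong (k +_) length≡) (sym (*-suc k m)))
    ; inRange = All.++⁺ (All.take⁺ i inRange′) (All.++⁺ (All.replicate⁺ k (s≤s z≤n , ≤-refl)) (All.drop⁺ i inRange′))
    ; occ≡ = occ≡′
    ; isStirling = trans (stirling-insertMax a (take i σ) (drop i σ) k (All.take⁺ i σ<a) (All.drop⁺ i σ<a))
                         (trans (cong stirling (take++drop≡id i σ)) isStirling)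
    }
    where
    open IsStirlingPerm σ-perm
    a = suc m
    σ<a = letters<suc m σ-perm
    inRange′ : All (λ v → 1 ≤ v × v ≤ a) σ
    inRange′ = All.map (λ { (v≥1 , v≤m) → v≥1 , m≤n⇒m≤1+n v≤m }) inRange
    occ≡′ : ∀ v → 1 ≤ v → v ≤ a → occ v (insertBlock a σ i) ≡ k
    occ≡′ v v≥1 v≤a with m≤n⇒m<n∨m≡n v≤a
    ... | inj₁ v<a =
        trans (occ-insertBlock a σ i v) (cong₂ _+_ (occ-replicate-other a v k (<⇒≢ v<a)) (occ≡ v v≥1 (≤-pred v<a)))
    ... | inj₂ refl =
        trans (occ-insertBlock a σ i v)
            (trans (cong₂ _+_ (occ-replicate-self a k) (occ-<-all a σ σ<a)) (+-identityʳ k))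

  insertBlock-at-length : (a : ℕ) (ys zs : List ℕ) → insertBlock a (ys ++ zs) (length ys) ≡ ys ++ replicate k a ++ zs
  insertBlock-at-length a [] zs = refl
  insertBlock-at-length a (y ∷ ys) zs = cong (y ∷_) (insertBlock-at-length a ys zs)

  deleteAll-insertBlock : (a : ℕ) (σ : List ℕ) (i : ℕ) → All (_< a) σ → deleteAll a (insertBlock a σ i) ≡ σ
  deleteAll-insertBlock a σ i σ<a = begin
    deleteAll a (take i σ ++ replicate k a ++ drop i σ)
      ≡⟨ deleteAll-++ a (take i σ) _ ⟩
    deleteAll a (take i σ) ++ deleteAll a (replicate k a ++ drop i σ)
      ≡⟨ cong (deleteAll a (take i σ) ++_) (deleteAll-++ a (replicate k a) (drop i σ)) ⟩
    deleteAll a (take i σ) ++ deleteAll a (replicate k a) ++ deleteAll a (drop i σ)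
      ≡⟨ cong₂ (λ u v → u ++ v ++ deleteAll a (drop i σ)) (deleteAll-below a (take i σ) (All.take⁺ i σ<a))
          (deleteAll-replicate a k) ⟩
    take i σ ++ deleteAll a (drop i σ)
      ≡⟨ cong (take i σ ++_) (deleteAll-below a (drop i σ) (All.drop⁺ i σ<a)) ⟩
    take i σ ++ drop i σ
      ≡⟨ take++drop≡id i σ ⟩
    σ ∎
    where open ≡-Reasoning

  firstIndex-insertBlock : 1 ≤ k → (a : ℕ) (σ : List ℕ) (i : ℕ) → All (_< a) σ → i ≤ length σ →
                           firstIndex a (insertBlock a σ i) ≡ i
  firstIndex-insertBlock k≥1 a σ i σ<a i≤ rewrite replicate-pred k a k≥1 =
    trans (firstIndex-below a (take i σ) _ (All.take⁺ i σ<a)) (trans (length-take i σ) (m≤n⇒m⊓n≡m i≤))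

  decompose-Q-suc : 1 ≤ k → (m : ℕ) {τ : List ℕ} → IsStirlingPerm k (suc m) τ →
    ∃ λ σ → ∃ λ i → IsStirlingPerm k m σ × i ≤ length σ × τ ≡ insertBlock (suc m) σ i
  decompose-Q-suc k≥1 m {τ} τ-perm
    with stirling-maxBlock (suc m) k τ k≥1 (IsStirlingPerm.isStirling τ-perm)
           (All.map proj₂ (IsStirlingPerm.inRange τ-perm)) (IsStirlingPerm.occ≡ τ-perm (suc m) (s≤s z≤n) ≤-refl)
  ... | ys , zs , refl , ys<a , zs<a =
    ys ++ zs , length ys , σ-perm , subst (length ys ≤_) (sym (length-++ ys)) (m≤m+n (length ys) (length zs)) ,
    sym insertBlock≡
    where
    open IsStirlingPerm τ-perm
    a = suc m
    insertBlock≡ : insertBlock a (ys ++ zs) (length ys) ≡ ys ++ replicate k a ++ zs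
    insertBlock≡ = insertBlock-at-length a ys zs
    ∈-insertBlock : ∀ {v} → v ∈ ys ++ zs → v ∈ ys ++ replicate k a ++ zs
    ∈-insertBlock v∈ with ∈-++⁻ ys v∈
    ... | inj₁ v∈ys = ∈-++⁺ˡ v∈ys
    ... | inj₂ v∈zs = ∈-++⁺ʳ ys (∈-++⁺ʳ (replicate k a) v∈zs)
    occ-deleteBlock : ∀ v → v ≢ a → occ v (ys ++ replicate k a ++ zs) ≡ occ v (ys ++ zs)
    occ-deleteBlock v v≢a = begin
      occ v (ys ++ replicate k a ++ zs)                 ≡⟨ cong (occ v) (sym insertBlock≡) ⟩
      occ v (insertBlock a (ys ++ zs) (length ys))       ≡⟨ occ-insertBlock a (ys ++ zs) (length ys) v ⟩
      occ v (replicate k a) + occ v (ys ++ zs)           ≡⟨ cong (_+ occ v (ys ++ zs))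
          (occ-replicate-other a v k v≢a) ⟩
      occ v (ys ++ zs)                                   ∎
      where open ≡-Reasoning
    σ-perm : IsStirlingPerm k m (ys ++ zs)
    σ-perm = record
      { length≡ = +-cancelˡ-≡ k _ _ (begin
          k + length (ys ++ zs)                           ≡⟨ sym (length-insertBlock a (ys ++ zs) (length ys)) ⟩
          length (insertBlock a (ys ++ zs) (length ys))   ≡⟨ cong length insertBlock≡ ⟩
          length (ys ++ replicate k a ++ zs)              ≡⟨ length≡ ⟩
          k * suc m                                       ≡⟨ *-suc k m ⟩
          k + k * m                                       ∎)
      ; inRange = All.tabulate (λ {v} v∈ → proj₁ (All.lookup inRange (∈-insertBlock v∈)) ,
                                           ≤-pred (All.lookup (All.++⁺ ys<a zs<a) v∈))
      ; occ≡ = λ v v≥1 v≤m → trans (sym (occ-deleteBlock v (<⇒≢ (s≤s v≤m)))) (occ≡ v v≥1 (m≤n⇒m≤1+n v≤m))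
      ; isStirling = trans (sym (stirling-insertMax a ys zs k ys<a zs<a)) isStirling
      }
      where open ≡-Reasoning

  ∑-Q-suc : 1 ≤ k → (m : ℕ) (f : List ℕ → ℕ) →
            ∑ f (Q (suc m) k) ≡ ∑ (λ σ → ∑< (suc (k * m)) (λ i → f (insertBlock (suc m) σ i))) (Q m k)
  ∑-Q-suc k≥1 m f = begin
    ∑ f (Q (suc m) k)
      ≡⟨ ∑-unique-cong f (Unique-Q k (suc m)) unique-insertions Q⊆ ⊆Q ⟩
    ∑ f (concatMap insertions (Q m k))
      ≡⟨ ∑-concatMap f insertions (Q m k) ⟩
    ∑ (λ σ → ∑ f (insertions σ)) (Q m k)
      ≡⟨ ∑-ext (Q m k) (λ σ → trans (∑-map f (insertBlock a σ) (upTo (suc (k * m))))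
                                    (∑-upTo (f ∘ insertBlock a σ) (suc (k * m)))) ⟩
    ∑ (λ σ → ∑< (suc (k * m)) (λ i → f (insertBlock (suc m) σ i))) (Q m k) ∎
    where
    open ≡-Reasoning
    a = suc m
    insertions : List ℕ → List (List ℕ)
    insertions σ = map (insertBlock a σ) (upTo (suc (k * m)))
    σ<a : ∀ {σ} → σ ∈ Q m k → All (_< a) σ
    σ<a σ∈ = letters<suc m (∈-Q⁻ k m σ∈)
    i≤length : ∀ {σ i} → σ ∈ Q m k → i ∈ upTo (suc (k * m)) → i ≤ length σ
    i≤length σ∈ i∈ = subst (_ ≤_) (sym (IsStirlingPerm.length≡ (∈-Q⁻ k m σ∈))) (≤-pred (∈-upTo⁻ i∈))
    unique-insertions : Unique (concatMap insertions (Q m k))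
    unique-insertions = Unique-concatMap-inv insertions (deleteAll a) (Unique-Q k m)
      (λ σ σ∈ → Unique-map-inv (insertBlock a σ) (firstIndex a) (Unique.upTo⁺ _)
                  (λ i i∈ → firstIndex-insertBlock k≥1 a σ i (σ<a σ∈) (i≤length σ∈ i∈)))
      (λ σ τ σ∈ τ∈ → let i , _ , τ≡ = ∈-map⁻ (insertBlock a σ) {xs = upTo (suc (k * m))} τ∈ in
                     trans (cong (deleteAll a) τ≡) (deleteAll-insertBlock a σ i (σ<a σ∈)))
    Q⊆ : ∀ τ → τ ∈ Q (suc m) k → τ ∈ concatMap insertions (Q m k)
    Q⊆ τ τ∈ with decompose-Q-suc k≥1 m (∈-Q⁻ k (suc m) τ∈)
    ... | σ , i , σ-perm , i≤ , refl =
      ∈-concatMap-intro insertions (∈-Q⁺ k m σ-perm)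
        (∈-map⁺ (insertBlock a σ) (∈-upTo⁺ (s≤s (subst (i ≤_) (IsStirlingPerm.length≡ σ-perm) i≤))))
    ⊆Q : ∀ τ → τ ∈ concatMap insertions (Q m k) → τ ∈ Q (suc m) k
    ⊆Q τ τ∈ with ∈-concatMap-elim insertions {xs = Q m k} τ∈
    ... | σ , σ∈ , τ∈′ with ∈-map⁻ (insertBlock a σ) {xs = upTo (suc (k * m))} τ∈′
    ...   | i , _ , refl = ∈-Q⁺ k (suc m) (insertBlock-isStirlingPerm m i (∈-Q⁻ k m σ∈))

  gapTypesFrom<suc : ∀ pre w → ProperPlateaus pre w → All (_< suc k) (gapTypesFrom pre w)
  gapTypesFrom<suc pre [] _ = []
  gapTypesFrom<suc pre (a ∷ []) _ = []
  gapTypesFrom<suc pre (a ∷ b ∷ w) (proper , propers) =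
      gapType<suc (cmpᵇ a b) ∷ gapTypesFrom<suc (a ∷ pre) (b ∷ w) propers
    where
    gapType<suc : Cmpᵇ a b → gapType pre a b < suc k
    gapType<suc (ltᵇ _ a<ᵇb _ _) rewrite a<ᵇb = ≤-refl
    gapType<suc (gtᵇ _ a<ᵇb b<ᵇa _) rewrite a<ᵇb | b<ᵇa = s≤s (m∸n≤m k 1)
    gapType<suc (eqᵇ refl a<ᵇb _ _) rewrite a<ᵇb = ≤-trans (n≤1+n _) (≤-trans (proper refl) (n≤1+n k))

  properPlateaus-perm : (m : ℕ) {σ : List ℕ} → IsStirlingPerm k m σ → 1 ≤ length σ → ProperPlateaus [] (pad σ)
  properPlateaus-perm m {s ∷ σ} σ-perm _ = properPlateaus-pad s σ (All.map proj₁ inRange) occ≤k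
    where
    open IsStirlingPerm σ-perm
    occ≤k : ∀ a → 1 ≤ a → occ a (s ∷ σ) ≤ k
    occ≤k a a≥1 with a ≤? m
    ... | yes a≤m = ≤-reflexive (occ≡ a a≥1 a≤m)
    ... | no a≰m =
        ≤-trans (≤-reflexive
            (occ-<-all a (s ∷ σ) (All.map (λ v≤m → <-≤-trans (s≤s v≤m) (≰⇒> a≰m)) (All.map proj₂ inRange)))) z≤n

  gapTypes<suc : (m : ℕ) {σ : List ℕ} → IsStirlingPerm k m σ → All (_< suc k) (gapTypes σ)
  gapTypes<suc m {[]} _ = s≤s z≤n ∷ []
  gapTypes<suc m {s ∷ σ} σ-perm = gapTypesFrom<suc [] (pad (s ∷ σ)) (properPlateaus-perm m σ-perm (s≤s z≤n))

  length-gapTypes : (σ : List ℕ) → length (gapTypes σ) ≡ suc (length σ)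
  length-gapTypes σ = length-gapTypesFrom [] (0 ∷ σ) 0

  module _ (x : ℕ → ℕ) where
    open Grammar x (suc k)

    D-suc-gapTypeCount : 1 ≤ k → (m r : ℕ) {σ : List ℕ} → IsStirlingPerm k m σ →
      D (suc r) (gapTypeCount σ) ≡ ∑< (suc (k * m)) (λ i → D r (gapTypeCount (insertBlock (suc m) σ i)))
    D-suc-gapTypeCount k≥1 m r {σ} σ-perm = begin
      ∑< (suc k) (λ t → occ t (gapTypes σ) * D r (raiseExcept t (gapTypeCount σ)))
        ≡⟨ ∑<-occ (suc k) (λ t → D r (raiseExcept t (gapTypeCount σ))) (gapTypes σ) (gapTypes<suc m σ-perm) ⟩
      ∑ (λ g → D r (raiseExcept g (gapTypeCount σ))) (gapTypes σ)
        ≡⟨ ∑-nth (λ g → D r (raiseExcept g (gapTypeCount σ))) (gapTypes σ) ⟩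
      ∑< (length (gapTypes σ)) (λ i → D r (raiseExcept (nth (gapTypes σ) i) (gapTypeCount σ)))
        ≡⟨ cong (λ L → ∑< L (λ i → D r (raiseExcept (nth (gapTypes σ) i) (gapTypeCount σ))))
                (trans (length-gapTypes σ) (cong suc length≡)) ⟩
      ∑< (suc (k * m)) (λ i → D r (raiseExcept (nth (gapTypes σ) i) (gapTypeCount σ)))
        ≡⟨ ∑<-cong (suc (k * m)) (λ i i≤km → D-cong r (λ t t≤k → sym
             (gapTypeCount-insertBlock (suc m) σ i t k≥1 (s≤s z≤n) (letters<suc m σ-perm)
                                       (subst (i ≤_) (sym length≡) (≤-pred i≤km)) t≤k))) ⟩
      ∑< (suc (k * m)) (λ i → D r (gapTypeCount (insertBlock (suc m) σ i))) ∎
      where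
      open ≡-Reasoning
      open IsStirlingPerm σ-perm
      ∑-nth : (h : ℕ → ℕ) (g : List ℕ) → ∑ h g ≡ ∑< (length g) (λ i → h (nth g i))
      ∑-nth h [] = refl
      ∑-nth h (y ∷ g) = cong (h y +_) (∑-nth h g)

    ∑-D-Q-suc : 1 ≤ k → (m r : ℕ) →
                ∑ (D (suc r) ∘ gapTypeCount) (Q m k) ≡ ∑ (D r ∘ gapTypeCount) (Q (suc m) k)
    ∑-D-Q-suc k≥1 m r = trans (∑-cong (Q m k) (λ σ σ∈ → D-suc-gapTypeCount k≥1 m r (∈-Q⁻ k m σ∈)))
                              (sym (∑-Q-suc k≥1 m (D r ∘ gapTypeCount)))

    ∑-D-Q-one : 1 ≤ k → (r : ℕ) → ∑ (D r ∘ gapTypeCount) (Q 1 k) ≡ D r (λ _ → 1)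
    ∑-D-Q-one k≥1 r = begin
      ∑ (D r ∘ gapTypeCount) (Q 1 k)
        ≡⟨ ∑-Q-suc k≥1 0 (D r ∘ gapTypeCount) ⟩
      ∑ (λ σ → ∑< (suc (k * 0)) (λ i → D r (gapTypeCount (insertBlock 1 σ i)))) (Q 0 k)
        ≡⟨ cong (∑ (λ σ → ∑< (suc (k * 0)) (λ i → D r (gapTypeCount (insertBlock 1 σ i))))) Q-zero ⟩
      ∑< (suc (k * 0)) (λ i → D r (gapTypeCount (insertBlock 1 [] i))) + 0
        ≡⟨ cong (λ L → ∑< (suc L) (λ i → D r (gapTypeCount (insertBlock 1 [] i))) + 0) (*-zeroʳ k) ⟩
      D r (gapTypeCount (insertBlock 1 [] 0)) + 0 + 0
        ≡⟨ trans (+-identityʳ _) (+-identityʳ _) ⟩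
      D r (gapTypeCount (insertBlock 1 [] 0))
        ≡⟨ D-cong r (λ t t≤k → trans (gapTypeCount-insertBlock 1 [] 0 t k≥1 (s≤s z≤n) [] z≤n t≤k) (one t)) ⟩
      D r (λ _ → 1) ∎
      where
      open ≡-Reasoning
      Q-zero : Q 0 k ≡ [] ∷ []
      Q-zero rewrite *-zeroʳ k = refl
      one : ∀ t → raiseExcept 0 (gapTypeCount []) t ≡ 1
      one zero = refl
      one (suc t) = refl

    ∑-D-Q : 1 ≤ k → (j r : ℕ) → ∑ (D r ∘ gapTypeCount) (Q (suc j) k) ≡ D (j + r) (λ _ → 1)
    ∑-D-Q k≥1 zero r = ∑-D-Q-one k≥1 r
    ∑-D-Q k≥1 (suc j) r = begin
      ∑ (D r ∘ gapTypeCount) (Q (suc (suc j)) k)     ≡⟨ sym (∑-D-Q-suc k≥1 (suc j) r) ⟩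
      ∑ (D (suc r) ∘ gapTypeCount) (Q (suc j) k)     ≡⟨ ∑-D-Q k≥1 j (suc r) ⟩
      D (j + suc r) (λ _ → 1)                        ≡⟨ cong (λ i → D i (λ _ → 1)) (+-suc j r) ⟩
      D (suc j + r) (λ _ → 1)                        ∎
      where open ≡-Reasoning

    C≡D : 1 ≤ k → (j : ℕ) → C (suc j) k x ≡ D j (λ _ → 1)
    C≡D k≥1 j = begin
      ∑ (weight k x) (Q (suc j) k)                    ≡⟨ ∑-cong (Q (suc j) k)
          (λ σ σ∈ → weight≡mono x k≥1 σ (proper σ∈)) ⟩
      ∑ (D 0 ∘ gapTypeCount) (Q (suc j) k)            ≡⟨ ∑-D-Q k≥1 j 0 ⟩
      D (j + 0) (λ _ → 1)                             ≡⟨ cong (λ i → D i (λ _ → 1)) (+-identityʳ j) ⟩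
      D j (λ _ → 1)                                   ∎
      where
      open ≡-Reasoning
      proper : ∀ {σ} → σ ∈ Q (suc j) k → ProperPlateaus [] (pad σ)
      proper σ∈ = properPlateaus-perm (suc j) σ-perm
        (subst (1 ≤_) (sym (IsStirlingPerm.length≡ σ-perm)) (*-mono-≤ k≥1 (s≤s z≤n)))
        where σ-perm = ∈-Q⁻ k (suc j) σ∈


-- Masks and elementary symmetric functions

-- masks N d: the length-N Boolean lists with exactly d entries false, i.e. the (N ∸ d)-element
-- subsets of {0, …, N ∸ 1}
masks : ℕ → ℕ → List (List Bool)
masks zero zero = [] ∷ []
masks zero (suc d) = []
masks (suc N) zero = map (true ∷_) (masks N zero)
masks (suc N) (suc d) = map (true ∷_) (masks N (suc d)) ++ map (false ∷_) (masks N d)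

indicator : List Bool → ℕ → ℕ
indicator [] _ = 0
indicator (β ∷ _) zero = if β then 1 else 0
indicator (_ ∷ b) (suc t) = indicator b t

clear : ℕ → List Bool → List Bool
clear _ [] = []
clear zero (_ ∷ b) = false ∷ b
clear (suc t) (β ∷ b) = β ∷ clear t b

truePositions : List Bool → List ℕ
truePositions [] = []
truePositions (true ∷ b) = 0 ∷ map suc (truePositions b)
truePositions (false ∷ b) = map suc (truePositions b)

dropOne : List Bool → List (List Bool)
dropOne [] = []
dropOne (true ∷ b) = (false ∷ b) ∷ map (true ∷_) (dropOne b)
dropOne (false ∷ b) = map (false ∷_) (dropOne b)

length-masks : (N d : ℕ) {b : List Bool} → b ∈ masks N d → length b ≡ N
length-masks zero zero (here refl) = refl
length-masks (suc N) zero b∈ with ∈-map⁻ (true ∷_) b∈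
... | b , b∈′ , refl = cong suc (length-masks N zero b∈′)
length-masks (suc N) (suc d) b∈ with ∈-++⁻ (map (true ∷_) (masks N (suc d))) b∈
... | inj₁ b∈₁ with ∈-map⁻ (true ∷_) b∈₁
...   | b , b∈′ , refl = cong suc (length-masks N (suc d) b∈′)
length-masks (suc N) (suc d) b∈ | inj₂ b∈₂ with ∈-map⁻ (false ∷_) b∈₂
...   | b , b∈′ , refl = cong suc (length-masks N d b∈′)

masks-zero : (N : ℕ) → masks N 0 ≡ replicate N true ∷ []
masks-zero zero = refl
masks-zero (suc N) rewrite masks-zero N = refl

masks-empty : (N d : ℕ) → N < d → masks N d ≡ []
masks-empty zero (suc d) _ = refl
masks-empty (suc N) (suc d) (s≤s N<d) rewrite masks-empty N (suc d) (m≤n⇒m≤1+n N<d) | masks-empty N d N<d = refl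

indicator-full : (N t : ℕ) → t < N → indicator (replicate N true) t ≡ 1
indicator-full (suc N) zero _ = refl
indicator-full (suc N) (suc t) (s≤s t<N) = indicator-full N t t<N

indicator-clear : (t : ℕ) (b : List Bool) (s : ℕ) → indicator (clear t b) s ≡ (if s ≡ᵇ t then 0 else indicator b s)
indicator-clear t [] s with s ≡ᵇ t
... | true = refl
... | false = refl
indicator-clear zero (β ∷ b) zero = refl
indicator-clear zero (β ∷ b) (suc s) = refl
indicator-clear (suc t) (β ∷ b) zero = refl
indicator-clear (suc t) (β ∷ b) (suc s) = indicator-clear t b s

indicator-truePositions : (b : List Bool) {t : ℕ} → t ∈ truePositions b → indicator b t ≡ 1
indicator-truePositions (true ∷ b) (here refl) = refl
indicator-truePositions (true ∷ b) (there t∈) with ∈-map⁻ suc t∈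
... | t , t∈′ , refl = indicator-truePositions b t∈′
indicator-truePositions (false ∷ b) t∈ with ∈-map⁻ suc t∈
... | t , t∈′ , refl = indicator-truePositions b t∈′

∑<-indicator : (b : List Bool) (H : ℕ → ℕ) → ∑< (length b) (λ t → indicator b t * H t) ≡ ∑ H (truePositions b)
∑<-indicator [] H = refl
∑<-indicator (true ∷ b) H =
    cong₂ _+_ (+-identityʳ (H 0)) (trans (∑<-indicator b (H ∘ suc)) (sym (∑-map H suc (truePositions b))))
∑<-indicator (false ∷ b) H = trans (∑<-indicator b (H ∘ suc)) (sym (∑-map H suc (truePositions b)))

dropOne≡map-clear : (b : List Bool) → dropOne b ≡ map (λ t → clear t b) (truePositions b)
dropOne≡map-clear [] = refl
dropOne≡map-clear (true ∷ b) =
  cong ((false ∷ b) ∷_) (trans (cong (map (true ∷_)) (dropOne≡map-clear b))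
                               (trans (sym (map-∘ (truePositions b))) (map-∘ (truePositions b))))
dropOne≡map-clear (false ∷ b) =
  trans (cong (map (false ∷_)) (dropOne≡map-clear b))
      (trans (sym (map-∘ (truePositions b))) (map-∘ (truePositions b)))

module _ (g : List Bool → ℕ) where

  ∑-dropOne-true : (L : List (List Bool)) →
    ∑ (λ b → ∑ g (dropOne b)) (map (true ∷_) L) ≡ ∑ (g ∘ (false ∷_)) L + ∑ (λ b → ∑ (g ∘ (true ∷_)) (dropOne b)) L
  ∑-dropOne-true L = begin
    ∑ (λ b → ∑ g (dropOne b)) (map (true ∷_) L)
      ≡⟨ ∑-map _ (true ∷_) L ⟩
    ∑ (λ b → g (false ∷ b) + ∑ g (map (true ∷_) (dropOne b))) L
      ≡⟨ ∑-+ (g ∘ (false ∷_)) _ L ⟩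
    ∑ (g ∘ (false ∷_)) L + ∑ (λ b → ∑ g (map (true ∷_) (dropOne b))) L
      ≡⟨ cong (∑ (g ∘ (false ∷_)) L +_) (∑-ext L (λ b → ∑-map g (true ∷_) (dropOne b))) ⟩
    ∑ (g ∘ (false ∷_)) L + ∑ (λ b → ∑ (g ∘ (true ∷_)) (dropOne b)) L ∎
    where open ≡-Reasoning

  ∑-dropOne-false : (L : List (List Bool)) →
    ∑ (λ b → ∑ g (dropOne b)) (map (false ∷_) L) ≡ ∑ (λ b → ∑ (g ∘ (false ∷_)) (dropOne b)) L
  ∑-dropOne-false L = trans (∑-map _ (false ∷_) L) (∑-ext L (λ b → ∑-map g (false ∷_) (dropOne b)))

  ∑-masks-suc : (N d : ℕ) →
      ∑ g (masks (suc N) (suc d)) ≡ ∑ (g ∘ (true ∷_)) (masks N (suc d)) + ∑ (g ∘ (false ∷_)) (masks N d)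
  ∑-masks-suc N d = trans (∑-++ g (map (true ∷_) (masks N (suc d))) _)
                          (cong₂ _+_ (∑-map g (true ∷_) (masks N (suc d))) (∑-map g (false ∷_) (masks N d)))

-- Double counting: each mask with d + 1 false entries arises from exactly d + 1 masks with d false
-- entries by clearing one true entry.
∑-dropOne : (N d : ℕ) (g : List Bool → ℕ) → ∑ (λ b → ∑ g (dropOne b)) (masks N d) ≡ suc d * ∑ g (masks N (suc d))
∑-dropOne zero zero g = refl
∑-dropOne zero (suc d) g = sym (*-zeroʳ (suc (suc d)))
∑-dropOne (suc N) zero g = begin
  ∑ (λ b → ∑ g (dropOne b)) (map (true ∷_) (masks N 0))
    ≡⟨ ∑-dropOne-true g (masks N 0) ⟩
  ∑ (g ∘ (false ∷_)) (masks N 0) + ∑ (λ b → ∑ (g ∘ (true ∷_)) (dropOne b)) (masks N 0)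
    ≡⟨ cong (∑ (g ∘ (false ∷_)) (masks N 0) +_) (trans (∑-dropOne N 0 (g ∘ (true ∷_))) (*-identityˡ _)) ⟩
  ∑ (g ∘ (false ∷_)) (masks N 0) + ∑ (g ∘ (true ∷_)) (masks N 1)
    ≡⟨ +-comm (∑ (g ∘ (false ∷_)) (masks N 0)) _ ⟩
  ∑ (g ∘ (true ∷_)) (masks N 1) + ∑ (g ∘ (false ∷_)) (masks N 0)
    ≡⟨ sym (trans (*-identityˡ _) (∑-masks-suc g N 0)) ⟩
  1 * ∑ g (masks (suc N) 1) ∎
  where open ≡-Reasoning
∑-dropOne (suc N) (suc d) g = begin
  ∑ (λ b → ∑ g (dropOne b)) (map (true ∷_) (masks N (suc d)) ++ map (false ∷_) (masks N d))
    ≡⟨ ∑-++ _ (map (true ∷_) (masks N (suc d))) _ ⟩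
  ∑ (λ b → ∑ g (dropOne b)) (map (true ∷_) (masks N (suc d))) + ∑ (λ b → ∑ g (dropOne b)) (map (false ∷_) (masks N d))
    ≡⟨ cong₂ _+_ (∑-dropOne-true g (masks N (suc d))) (∑-dropOne-false g (masks N d)) ⟩
  A + ∑ (λ b → ∑ (g ∘ (true ∷_)) (dropOne b)) (masks N (suc d)) + ∑ (λ b → ∑ (g ∘ (false ∷_)) (dropOne b)) (masks N d)
    ≡⟨ cong₂ (λ u v → A + u + v) (∑-dropOne N (suc d) (g ∘ (true ∷_))) (∑-dropOne N d (g ∘ (false ∷_))) ⟩
  A + suc (suc d) * B + suc d * A
    ≡⟨ regroup A B (suc d) ⟩
  suc (suc d) * (B + A)
    ≡⟨ cong (suc (suc d) *_) (sym (∑-masks-suc g N (suc d))) ⟩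
  suc (suc d) * ∑ g (masks (suc N) (suc (suc d))) ∎
  where
  open ≡-Reasoning
  A = ∑ (g ∘ (false ∷_)) (masks N (suc d))
  B = ∑ (g ∘ (true ∷_)) (masks N (suc (suc d)))
  regroup : ∀ a b e → a + suc e * b + e * a ≡ suc e * (b + a)
  regroup a b e = begin
    a + suc e * b + e * a   ≡⟨ cong (_+ e * a) (+-comm a (suc e * b)) ⟩
    suc e * b + a + e * a   ≡⟨ +-assoc (suc e * b) a (e * a) ⟩
    suc e * b + suc e * a   ≡⟨ sym (*-distribˡ-+ (suc e) b a) ⟩
    suc e * (b + a)         ∎

esym-zero : (ys : List ℕ) → esym ys 0 ≡ 1
esym-zero [] = refl
esym-zero (_ ∷ _) = refl

esym-> : (ys : List ℕ) (n : ℕ) → length ys ≤ n → esym ys (suc n) ≡ 0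
esym-> [] n _ = refl
esym-> (y ∷ ys) (suc n) (s≤s len≤n)
  rewrite esym-> ys n len≤n | esym-> ys (suc n) (m≤n⇒m≤1+n len≤n) = trans (+-identityʳ _) (*-zeroʳ y)

module _ (x : ℕ → ℕ) (N : ℕ) (L : List (List Bool)) where
  open Grammar

  ∑-mono-true∷ : ∑ (mono x (suc N) ∘ indicator) (map (true ∷_) L) ≡ x 1 * ∑ (mono (x ∘ suc) N ∘ indicator) L
  ∑-mono-true∷ = trans (∑-map _ (true ∷_) L)
                       (trans (∑-*ˡ (x 1 * 1) _ L) (cong (_* ∑ (mono (x ∘ suc) N ∘ indicator) L) (*-identityʳ (x 1))))

  ∑-mono-false∷ : ∑ (mono x (suc N) ∘ indicator) (map (false ∷_) L) ≡ ∑ (mono (x ∘ suc) N ∘ indicator) L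
  ∑-mono-false∷ = trans (∑-map _ (false ∷_) L) (∑-ext L (λ b → +-identityʳ _))

∑-masks-mono : (x : ℕ → ℕ) (N d : ℕ) → d ≤ N →
  ∑ (Grammar.mono x N ∘ indicator) (masks N d) ≡ esym (applyUpTo (x ∘ suc) N) (N ∸ d)
∑-masks-mono x zero zero _ = refl
∑-masks-mono x (suc N) zero _ = begin
  ∑ (mono ∘ indicator) (map (true ∷_) (masks N 0))   ≡⟨ ∑-mono-true∷ x N (masks N 0) ⟩
  x 1 * ∑ (mono′ ∘ indicator) (masks N 0)            ≡⟨ cong (x 1 *_) (∑-masks-mono (x ∘ suc) N 0 z≤n) ⟩
  x 1 * esym ys N                                    ≡⟨ sym (+-identityʳ _) ⟩
  x 1 * esym ys N + 0                                ≡⟨ cong (x 1 * esym ys N +_) (sym (esym-> ys N ys≤N)) ⟩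
  x 1 * esym ys N + esym ys (suc N)                  ∎
  where
  open ≡-Reasoning
  open Grammar x (suc N)
  mono′ = Grammar.mono (x ∘ suc) N
  ys = applyUpTo (x ∘ suc ∘ suc) N
  ys≤N = ≤-reflexive (length-applyUpTo (x ∘ suc ∘ suc) N)
∑-masks-mono x (suc N) (suc d) (s≤s d≤N) = begin
  ∑ (mono ∘ indicator) (map (true ∷_) (masks N (suc d)) ++ map (false ∷_) (masks N d))
    ≡⟨ ∑-++ (mono ∘ indicator) (map (true ∷_) (masks N (suc d))) _ ⟩
  ∑ (mono ∘ indicator) (map (true ∷_) (masks N (suc d))) + ∑ (mono ∘ indicator) (map (false ∷_) (masks N d))
    ≡⟨ cong₂ _+_ (∑-mono-true∷ x N (masks N (suc d)))
                 (trans (∑-mono-false∷ x N (masks N d)) (∑-masks-mono (x ∘ suc) N d d≤N)) ⟩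
  x 1 * ∑ (mono′ ∘ indicator) (masks N (suc d)) + esym ys (N ∸ d)
    ≡⟨ last (m≤n⇒m<n∨m≡n d≤N) ⟩
  esym (x 1 ∷ ys) (N ∸ d) ∎
  where
  open ≡-Reasoning
  open Grammar x (suc N)
  mono′ = Grammar.mono (x ∘ suc) N
  ys = applyUpTo (x ∘ suc ∘ suc) N
  last : d < N ⊎ d ≡ N → x 1 * ∑ (mono′ ∘ indicator) (masks N (suc d)) + esym ys (N ∸ d) ≡ esym (x 1 ∷ ys) (N ∸ d)
  last (inj₁ d<N) rewrite ∑-masks-mono (x ∘ suc) N (suc d) d<N | +-∸-assoc 1 d<N = refl
  last (inj₂ refl) rewrite masks-empty d (suc d) ≤-refl | n∸n≡0 d | esym-zero ys | *-zeroʳ (x 1) = refl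


-- Increasing plane trees

leaf : ℕ → PTree
leaf a = node a []

insertEverywhere : {A : Set} → A → List A → List (List A)
insertEverywhere l [] = (l ∷ []) ∷ []
insertEverywhere l (t ∷ ts) = (l ∷ t ∷ ts) ∷ map (t ∷_) (insertEverywhere l ts)

mutual
  insertLeaf : ℕ → PTree → List PTree
  insertLeaf a (node b ts) = map (node b) (insertEverywhere (leaf a) ts) ++ map (node b) (insertLeafF a ts)

  insertLeafF : ℕ → List PTree → List (List PTree)
  insertLeafF a [] = []
  insertLeafF a (t ∷ ts) = map (_∷ ts) (insertLeaf a t) ++ map (t ∷_) (insertLeafF a ts)

-- the increasing plane trees on [m + 1]
incTrees : ℕ → List PTree
incTrees zero = leaf 1 ∷ []
incTrees (suc m) = concatMap (insertLeaf (suc (suc m))) (incTrees m)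

mutual
  degrees : PTree → List ℕ
  degrees (node b ts) = length ts ∷ degreesF ts

  degreesF : List PTree → List ℕ
  degreesF [] = []
  degreesF (t ∷ ts) = degrees t ++ degreesF ts

module _ {A : Set} (l : A) where

  length-insertEverywhere : (ts : List A) {ts′ : List A} → ts′ ∈ insertEverywhere l ts → length ts′ ≡ suc (length ts)
  length-insertEverywhere [] (here refl) = refl
  length-insertEverywhere (t ∷ ts) (here refl) = refl
  length-insertEverywhere (t ∷ ts) (there ts′∈) with ∈-map⁻ (t ∷_) ts′∈
  ... | ts′ , ts′∈′ , refl = cong suc (length-insertEverywhere ts ts′∈′)

  All-insertEverywhere : {P : A → Set} (ts : List A) {ts′ : List A} → ts′ ∈ insertEverywhere l ts →
                         All P ts → P l → All P ts′
  All-insertEverywhere [] (here refl) _ Pl = Pl ∷ []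
  All-insertEverywhere (t ∷ ts) (here refl) Pts Pl = Pl ∷ Pts
  All-insertEverywhere (t ∷ ts) (there ts′∈) (Pt ∷ Pts) Pl with ∈-map⁻ (t ∷_) ts′∈
  ... | ts′ , ts′∈′ , refl = Pt ∷ All-insertEverywhere ts ts′∈′ Pts Pl

  Unique-insertEverywhere : (ts : List A) → l ∉ ts → Unique (insertEverywhere l ts)
  Unique-insertEverywhere [] _ = [] ∷ []
  Unique-insertEverywhere (t ∷ ts) l∉ =
    All.tabulate head≢ ∷ Unique.map⁺ ∷-injectiveʳ (Unique-insertEverywhere ts (l∉ ∘ there))
    where
    head≢ : ∀ {ts′} → ts′ ∈ map (t ∷_) (insertEverywhere l ts) → (l ∷ t ∷ ts) ≢ ts′
    head≢ ts′∈ eq with ∈-map⁻ (t ∷_) ts′∈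
    head≢ ts′∈ refl | _ , _ , refl = l∉ (here refl)

insertEverywhere-labels : (l : PTree) (ts : List PTree) {ts′ : List PTree} → ts′ ∈ insertEverywhere l ts →
                          labelsF ts′ ↭ labels l ++ labelsF ts
insertEverywhere-labels l [] (here refl) = ↭-refl
insertEverywhere-labels l (t ∷ ts) (here refl) = ↭-refl
insertEverywhere-labels l (t ∷ ts) (there ts′∈) with ∈-map⁻ (t ∷_) ts′∈
... | ts′ , ts′∈′ , refl =
    ↭-trans (↭.++⁺ˡ (labels t) (insertEverywhere-labels l ts ts′∈′)) (↭.shifts (labels t) (labels l))

length-insertLeafF : (a : ℕ) (ts : List PTree) {ts′ : List PTree} → ts′ ∈ insertLeafF a ts → length ts′ ≡ length ts
length-insertLeafF a (t ∷ ts) ts′∈ with ∈-++⁻ (map (_∷ ts) (insertLeaf a t)) ts′∈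
... | inj₁ ts′∈₁ with ∈-map⁻ (_∷ ts) ts′∈₁
...   | _ , _ , refl = refl
length-insertLeafF a (t ∷ ts) ts′∈ | inj₂ ts′∈₂ with ∈-map⁻ (t ∷_) ts′∈₂
...   | ts′ , ts′∈′ , refl = cong suc (length-insertLeafF a ts ts′∈′)

mutual
  insertLeaf-labels : (a : ℕ) (T : PTree) {T′ : PTree} → T′ ∈ insertLeaf a T → labels T′ ↭ a ∷ labels T
  insertLeaf-labels a (node b ts) T′∈ with ∈-++⁻ (map (node b) (insertEverywhere (leaf a) ts)) T′∈
  ... | inj₁ T′∈₁ with ∈-map⁻ (node b) T′∈₁
  ...   | ts′ , ts′∈ , refl = ↭-trans (↭-prep b (insertEverywhere-labels (leaf a) ts ts′∈)) (↭-swap b a ↭-refl)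
  insertLeaf-labels a (node b ts) T′∈ | inj₂ T′∈₂ with ∈-map⁻ (node b) T′∈₂
  ...   | ts′ , ts′∈ , refl = ↭-trans (↭-prep b (insertLeafF-labels a ts ts′∈)) (↭-swap b a ↭-refl)

  insertLeafF-labels : (a : ℕ) (ts : List PTree) {ts′ : List PTree} → ts′ ∈ insertLeafF a ts →
      labelsF ts′ ↭ a ∷ labelsF ts
  insertLeafF-labels a (t ∷ ts) ts′∈ with ∈-++⁻ (map (_∷ ts) (insertLeaf a t)) ts′∈
  ... | inj₁ ts′∈₁ with ∈-map⁻ (_∷ ts) ts′∈₁
  ...   | t′ , t′∈ , refl = ↭.++⁺ʳ (labelsF ts) (insertLeaf-labels a t t′∈)
  insertLeafF-labels a (t ∷ ts) ts′∈ | inj₂ ts′∈₂ with ∈-map⁻ (t ∷_) ts′∈₂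
  ...   | ts′ , ts′∈ , refl =
      ↭-trans (↭.++⁺ˡ (labels t) (insertLeafF-labels a ts ts′∈)) (↭.shift a (labels t) (labelsF ts))

rootLabel-insertLeaf : (a : ℕ) (T : PTree) {T′ : PTree} → T′ ∈ insertLeaf a T → rootLabel T′ ≡ rootLabel T
rootLabel-insertLeaf a (node b ts) T′∈ with ∈-++⁻ (map (node b) (insertEverywhere (leaf a) ts)) T′∈
... | inj₁ T′∈₁ with ∈-map⁻ (node b) T′∈₁
...   | _ , _ , refl = refl
rootLabel-insertLeaf a (node b ts) T′∈ | inj₂ T′∈₂ with ∈-map⁻ (node b) T′∈₂
...   | _ , _ , refl = refl

rootLabels-insertLeafF : {P : ℕ → Set} (a : ℕ) (ts : List PTree) {ts′ : List PTree} → ts′ ∈ insertLeafF a ts →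
                         All (P ∘ rootLabel) ts → All (P ∘ rootLabel) ts′
rootLabels-insertLeafF {P} a (t ∷ ts) ts′∈ (Pt ∷ Pts) with ∈-++⁻ (map (_∷ ts) (insertLeaf a t)) ts′∈
... | inj₁ ts′∈₁ with ∈-map⁻ (_∷ ts) ts′∈₁
...   | t′ , t′∈ , refl = subst P (sym (rootLabel-insertLeaf a t t′∈)) Pt ∷ Pts
rootLabels-insertLeafF {P} a (t ∷ ts) ts′∈ (Pt ∷ Pts) | inj₂ ts′∈₂ with ∈-map⁻ (t ∷_) ts′∈₂
...   | ts′ , ts′∈′ , refl = Pt ∷ rootLabels-insertLeafF {P} a ts ts′∈′ Pts

mutual
  insertLeaf-increasing : (a : ℕ) (T : PTree) {T′ : PTree} → Increasing T → All (_< a) (labels T) →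
                          T′ ∈ insertLeaf a T → Increasing T′
  insertLeaf-increasing a (node b ts) (inc b<roots incs) (b<a ∷ _) T′∈
    with ∈-++⁻ (map (node b) (insertEverywhere (leaf a) ts)) T′∈
  ... | inj₁ T′∈₁ with ∈-map⁻ (node b) T′∈₁
  ...   | ts′ , ts′∈ , refl =
    inc (All-insertEverywhere (leaf a) ts ts′∈ b<roots b<a) (All-insertEverywhere (leaf a) ts ts′∈ incs (inc [] []))
  insertLeaf-increasing a (node b ts) (inc b<roots incs) (_ ∷ ts<a) T′∈ | inj₂ T′∈₂ with ∈-map⁻ (node b) T′∈₂
  ...   | ts′ , ts′∈ , refl =
      inc (rootLabels-insertLeafF {b <_} a ts ts′∈ b<roots) (insertLeafF-increasing a ts incs ts<a ts′∈)

  insertLeafF-increasing : (a : ℕ) (ts : List PTree) {ts′ : List PTree} → All Increasing ts →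
                           All (_< a) (labelsF ts) → ts′ ∈ insertLeafF a ts → All Increasing ts′
  insertLeafF-increasing a (t ∷ ts) (inc-t ∷ incs) ts<a ts′∈ with ∈-++⁻ (map (_∷ ts) (insertLeaf a t)) ts′∈
  ... | inj₁ ts′∈₁ with ∈-map⁻ (_∷ ts) ts′∈₁
  ...   | t′ , t′∈ , refl = insertLeaf-increasing a t inc-t (All.++⁻ˡ (labels t) ts<a) t′∈ ∷ incs
  insertLeafF-increasing a (t ∷ ts) (inc-t ∷ incs) ts<a ts′∈ | inj₂ ts′∈₂ with ∈-map⁻ (t ∷_) ts′∈₂
  ...   | ts′ , ts′∈′ , refl = inc-t ∷ insertLeafF-increasing a ts incs (All.++⁻ʳ (labels t) ts<a) ts′∈′

oneTo-suc-↭ : (n : ℕ) → oneTo (suc n) ↭ suc n ∷ oneTo n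
oneTo-suc-↭ n = subst (_↭ suc n ∷ oneTo n) (sym oneTo-suc) (↭.++-comm (oneTo n) [ suc n ])
  where
  oneTo-suc : oneTo (suc n) ≡ oneTo n ++ [ suc n ]
  oneTo-suc = trans (cong (map suc) (sym (applyUpTo-∷ʳ id n))) (map-++ suc (upTo n) [ n ])

oneTo-inRange : (n : ℕ) → All (λ v → 1 ≤ v × v ≤ n) (oneTo n)
oneTo-inRange n = All.tabulate ∈-oneTo⁻

incTrees-sound : (m : ℕ) {T : PTree} → T ∈ incTrees m → IncPlaneTree (suc m) T
incTrees-sound zero (here refl) = inc [] [] , ↭-refl
incTrees-sound (suc m) {T} T∈ with ∈-concatMap-elim (insertLeaf (suc (suc m))) {xs = incTrees m} T∈
... | T₀ , T₀∈ , T∈′ with incTrees-sound m T₀∈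
...   | inc₀ , labels₀ =
  insertLeaf-increasing (suc (suc m)) T₀ inc₀ T₀<a T∈′ ,
  ↭-trans (insertLeaf-labels (suc (suc m)) T₀ T∈′)
      (↭-trans (↭-prep (suc (suc m)) labels₀) (↭-sym (oneTo-suc-↭ (suc m))))
  where
  T₀<a : All (_< suc (suc m)) (labels T₀)
  T₀<a = ↭.All-resp-↭ (↭-sym labels₀) (All.map (s≤s ∘ proj₂) (oneTo-inRange (suc m)))

mutual
  increasing-root≤ : (T : PTree) → Increasing T → All (rootLabel T ≤_) (labels T)
  increasing-root≤ (node b ts) (inc b<roots incs) = ≤-refl ∷ All.map <⇒≤ (increasing-root<F b ts b<roots incs)

  increasing-root<F : (b : ℕ) (ts : List PTree) → All (λ t → b < rootLabel t) ts → All Increasing ts →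
      All (b <_) (labelsF ts)
  increasing-root<F b [] [] [] = []
  increasing-root<F b (t ∷ ts) (b<t ∷ b<roots) (inc-t ∷ incs) =
    All.++⁺ (All.map (<-≤-trans b<t) (increasing-root≤ t inc-t)) (increasing-root<F b ts b<roots incs)

-- A maximal label a below the root sits on a leaf; cutting it off gives an increasing tree T₀ with
-- T ∈ insertLeaf a T₀.
LeafCutF : ℕ → List PTree → Set₁
LeafCutF a ts = ∃ λ ts₀ → (ts ∈ insertLeafF a ts₀ ⊎ ts ∈ insertEverywhere (leaf a) ts₀) × All Increasing ts₀ ×
                          (labelsF ts ↭ a ∷ labelsF ts₀) ×
                          (∀ {P : ℕ → Set} → All (P ∘ rootLabel) ts → All (P ∘ rootLabel) ts₀)

mutual
  cutLeaf : (a : ℕ) (T : PTree) → Increasing T → a ∈ labels T → rootLabel T ≢ a → All (_≤ a) (labels T) →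
    ∃ λ T₀ → T ∈ insertLeaf a T₀ × Increasing T₀ × (labels T ↭ a ∷ labels T₀) × rootLabel T₀ ≡ rootLabel T
  cutLeaf a (node b ts) _ (here a≡b) b≢a _ = ⊥-elim (b≢a (sym a≡b))
  cutLeaf a (node b ts) (inc b<roots incs) (there a∈) _ (_ ∷ ts≤a) with cutLeafF a ts incs a∈ ts≤a
  ... | ts₀ , inj₁ ts∈ , incs₀ , labels≈ , roots₀ =
    node b ts₀ , ∈-++⁺ʳ _ (∈-map⁺ (node b) ts∈) , inc (roots₀ {b <_} b<roots) incs₀ ,
    ↭-trans (↭-prep b labels≈) (↭-swap b a ↭-refl) , refl
  ... | ts₀ , inj₂ ts∈ , incs₀ , labels≈ , roots₀ =
    node b ts₀ , ∈-++⁺ˡ (∈-map⁺ (node b) ts∈) , inc (roots₀ {b <_} b<roots) incs₀ ,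
    ↭-trans (↭-prep b labels≈) (↭-swap b a ↭-refl) , refl

  cutLeafF : (a : ℕ) (ts : List PTree) → All Increasing ts → a ∈ labelsF ts → All (_≤ a) (labelsF ts) → LeafCutF a ts
  cutLeafF a (node c us ∷ ts) (inc-t ∷ incs) a∈ ≤a with ∈-++⁻ (labels (node c us)) a∈
  ... | inj₁ a∈t with c ≟ a
  ...   | yes refl = leafCase us inc-t (All.++⁻ˡ (labels (node a us)) ≤a)
    where
    leafCase : (us : List PTree) → Increasing (node a us) → All (_≤ a) (labels (node a us)) →
               LeafCutF a (node a us ∷ ts)
    leafCase [] _ _ = ts , inj₂ (leaf-first ts) , incs , ↭-refl , All.tail
      where
      leaf-first : (ts : List PTree) → leaf a ∷ ts ∈ insertEverywhere (leaf a) ts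
      leaf-first [] = here refl
      leaf-first (_ ∷ _) = here refl
    leafCase (node d vs ∷ _) (inc (a<d ∷ _) _) (_ ∷ us≤a) = ⊥-elim (<⇒≱ a<d (All.head us≤a))
  ...   | no c≢a with cutLeaf a (node c us) inc-t a∈t c≢a (All.++⁻ˡ (labels (node c us)) ≤a)
  ...     | t₀ , t∈ , inc₀ , labels≈ , root₀ =
    t₀ ∷ ts , inj₁ (∈-++⁺ˡ (∈-map⁺ (_∷ ts) t∈)) , inc₀ ∷ incs , ↭.++⁺ʳ (labelsF ts) labels≈ ,
    (λ { {P} (Pt ∷ Pts) → subst P (sym root₀) Pt ∷ Pts })
  cutLeafF a (t ∷ ts) (inc-t ∷ incs) a∈ ≤a | inj₂ a∈ts with cutLeafF a ts incs a∈ts (All.++⁻ʳ (labels t) ≤a)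
  ... | ts₀ , inj₁ ts∈ , incs₀ , labels≈ , roots₀ =
    t ∷ ts₀ , inj₁ (∈-++⁺ʳ _ (∈-map⁺ (t ∷_) ts∈)) , inc-t ∷ incs₀ ,
    ↭-trans (↭.++⁺ˡ (labels t) labels≈) (↭.shift a (labels t) (labelsF ts₀)) ,
    (λ { {P} (Pt ∷ Pts) → Pt ∷ roots₀ {P} Pts })
  ... | ts₀ , inj₂ ts∈ , incs₀ , labels≈ , roots₀ =
    t ∷ ts₀ , inj₂ (there (∈-map⁺ (t ∷_) ts∈)) , inc-t ∷ incs₀ ,
    ↭-trans (↭.++⁺ˡ (labels t) labels≈) (↭.shift a (labels t) (labelsF ts₀)) ,
    (λ { {P} (Pt ∷ Pts) → Pt ∷ roots₀ {P} Pts })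

module _ {n : ℕ} {T : PTree} (T-inc : IncPlaneTree n T) where

  ∈-labels : {v : ℕ} → 1 ≤ v → v ≤ n → v ∈ labels T
  ∈-labels v≥1 v≤n = ↭.∈-resp-↭ (↭-sym (proj₂ T-inc)) (∈-oneTo⁺ v≥1 v≤n)

  labels≤ : All (_≤ n) (labels T)
  labels≤ = ↭.All-resp-↭ (↭-sym (proj₂ T-inc)) (All.map proj₂ (oneTo-inRange n))

  rootLabel≤1 : 1 ≤ n → rootLabel T ≤ 1
  rootLabel≤1 n≥1 = All.lookup (increasing-root≤ T (proj₁ T-inc)) (∈-labels (s≤s z≤n) n≥1)

incTrees-complete : (m : ℕ) {T : PTree} → IncPlaneTree (suc m) T → T ∈ incTrees m
incTrees-complete zero {node b []} (_ , labels≈) with ↭.∈-resp-↭ labels≈ (here refl)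
... | here refl = here refl
incTrees-complete zero {node b (node c us ∷ ts)} (_ , labels≈) with ↭.↭-length labels≈
... | ()
incTrees-complete (suc m) {T} T-inc@(inc-T , labels≈)
  with cutLeaf (suc (suc m)) T inc-T (∈-labels T-inc (s≤s z≤n) ≤-refl)
               (λ root≡ → <⇒≱ (s≤s (s≤s z≤n)) (subst (_≤ 1) root≡ (rootLabel≤1 T-inc (s≤s z≤n)))) (labels≤ T-inc)
... | T₀ , T∈ , inc₀ , labels≈₀ , _ =
    ∈-concatMap-intro (insertLeaf (suc (suc m))) (incTrees-complete m (inc₀ , labels₀)) T∈
  where
  labels₀ : labels T₀ ↭ oneTo (suc m)
  labels₀ = ↭.drop-∷ (↭-trans (↭-sym labels≈₀) (↭-trans labels≈ (oneTo-suc-↭ (suc m))))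

mutual
  removeLeaf : ℕ → PTree → PTree
  removeLeaf a (node b ts) = node b (removeLeafF a ts)

  removeLeafF : ℕ → List PTree → List PTree
  removeLeafF a [] = []
  removeLeafF a (node c us ∷ ts) = if c ≡ᵇ a then ts else node c (removeLeafF a us) ∷ removeLeafF a ts

removeLeafF-∉ : (a : ℕ) (ts : List PTree) → a ∉ labelsF ts → removeLeafF a ts ≡ ts
removeLeafF-∉ a [] _ = refl
removeLeafF-∉ a (node c us ∷ ts) a∉ rewrite ≢⇒≡ᵇ-false c a (λ c≡a → a∉ (here (sym c≡a))) =
  cong₂ _∷_ (cong (node c) (removeLeafF-∉ a us (a∉ ∘ ∈-++⁺ˡ ∘ there)))
      (removeLeafF-∉ a ts (a∉ ∘ ∈-++⁺ʳ (c ∷ labelsF us)))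

removeLeaf-∉ : (a : ℕ) (T : PTree) → a ∉ labels T → removeLeaf a T ≡ T
removeLeaf-∉ a (node b ts) a∉ = cong (node b) (removeLeafF-∉ a ts (a∉ ∘ there))

removeLeafF-∷ : (a : ℕ) (t : PTree) (ts : List PTree) → rootLabel t ≢ a →
    removeLeafF a (t ∷ ts) ≡ removeLeaf a t ∷ removeLeafF a ts
removeLeafF-∷ a (node c us) ts c≢a rewrite ≢⇒≡ᵇ-false c a c≢a = refl

rootLabel-∉ : (t : PTree) {a : ℕ} → a ∉ labels t → rootLabel t ≢ a
rootLabel-∉ (node c us) a∉ refl = a∉ (here refl)

removeLeafF-insertEverywhere : (a : ℕ) (ts : List PTree) {ts′ : List PTree} → a ∉ labelsF ts →
                               ts′ ∈ insertEverywhere (leaf a) ts → removeLeafF a ts′ ≡ ts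
removeLeafF-insertEverywhere a [] _ (here refl) rewrite ≡ᵇ-refl a = refl
removeLeafF-insertEverywhere a (t ∷ ts) _ (here refl) rewrite ≡ᵇ-refl a = refl
removeLeafF-insertEverywhere a (t ∷ ts) a∉ (there ts′∈) with ∈-map⁻ (t ∷_) ts′∈
... | ts′ , ts′∈′ , refl =
  trans (removeLeafF-∷ a t ts′ (rootLabel-∉ t (a∉ ∘ ∈-++⁺ˡ)))
        (cong₂ _∷_ (removeLeaf-∉ a t (a∉ ∘ ∈-++⁺ˡ))
            (removeLeafF-insertEverywhere a ts (a∉ ∘ ∈-++⁺ʳ (labels t)) ts′∈′))

mutual
  removeLeaf-insertLeaf : (a : ℕ) (T : PTree) {T′ : PTree} → a ∉ labels T → T′ ∈ insertLeaf a T → removeLeaf a T′ ≡ T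
  removeLeaf-insertLeaf a (node b ts) a∉ T′∈ with ∈-++⁻ (map (node b) (insertEverywhere (leaf a) ts)) T′∈
  ... | inj₁ T′∈₁ with ∈-map⁻ (node b) T′∈₁
  ...   | ts′ , ts′∈ , refl = cong (node b) (removeLeafF-insertEverywhere a ts (a∉ ∘ there) ts′∈)
  removeLeaf-insertLeaf a (node b ts) a∉ T′∈ | inj₂ T′∈₂ with ∈-map⁻ (node b) T′∈₂
  ...   | ts′ , ts′∈ , refl = cong (node b) (removeLeafF-insertLeafF a ts (a∉ ∘ there) ts′∈)

  removeLeafF-insertLeafF : (a : ℕ) (ts : List PTree) {ts′ : List PTree} → a ∉ labelsF ts →
                            ts′ ∈ insertLeafF a ts → removeLeafF a ts′ ≡ ts
  removeLeafF-insertLeafF a (t ∷ ts) a∉ ts′∈ with ∈-++⁻ (map (_∷ ts) (insertLeaf a t)) ts′∈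
  ... | inj₁ ts′∈₁ with ∈-map⁻ (_∷ ts) ts′∈₁
  ...   | t′ , t′∈ , refl =
    trans (removeLeafF-∷ a t′ ts (rootLabel-∉ t (a∉ ∘ ∈-++⁺ˡ) ∘ trans (sym (rootLabel-insertLeaf a t t′∈))))
          (cong₂ _∷_ (removeLeaf-insertLeaf a t (a∉ ∘ ∈-++⁺ˡ) t′∈) (removeLeafF-∉ a ts (a∉ ∘ ∈-++⁺ʳ (labels t))))
  removeLeafF-insertLeafF a (t ∷ ts) a∉ ts′∈ | inj₂ ts′∈₂ with ∈-map⁻ (t ∷_) ts′∈₂
  ...   | ts′ , ts′∈ , refl =
    trans (removeLeafF-∷ a t ts′ (rootLabel-∉ t (a∉ ∘ ∈-++⁺ˡ)))
          (cong₂ _∷_ (removeLeaf-∉ a t (a∉ ∘ ∈-++⁺ˡ)) (removeLeafF-insertLeafF a ts (a∉ ∘ ∈-++⁺ʳ (labels t)) ts′∈))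

leaf∉ : (a : ℕ) (ts : List PTree) → a ∉ labelsF ts → leaf a ∉ ts
leaf∉ a (t ∷ ts) a∉ (here refl) = a∉ (here refl)
leaf∉ a (t ∷ ts) a∉ (there leaf∈) = leaf∉ a ts (a∉ ∘ ∈-++⁺ʳ (labels t)) leaf∈

node-injectiveʳ : {b : ℕ} {us vs : List PTree} → node b us ≡ node b vs → us ≡ vs
node-injectiveʳ refl = refl

mutual
  Unique-insertLeaf : (a : ℕ) (T : PTree) → a ∉ labels T → Unique (insertLeaf a T)
  Unique-insertLeaf a (node b ts) a∉ =
    Unique.++⁺ (Unique.map⁺ node-injectiveʳ (Unique-insertEverywhere (leaf a) ts (leaf∉ a ts (a∉ ∘ there))))
               (Unique.map⁺ node-injectiveʳ (Unique-insertLeafF a ts (a∉ ∘ there))) disjoint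
    where
    disjoint : ∀ {T′} → ¬ (T′ ∈ map (node b) (insertEverywhere (leaf a) ts) × T′ ∈ map (node b) (insertLeafF a ts))
    disjoint (T′∈₁ , T′∈₂) with ∈-map⁻ (node b) T′∈₁ | ∈-map⁻ (node b) T′∈₂
    ... | ts₁ , ts₁∈ , refl | ts₂ , ts₂∈ , eq with node-injectiveʳ eq
    ...   | refl =
        1+n≰n (≤-reflexive (trans (sym (length-insertEverywhere (leaf a) ts ts₁∈)) (length-insertLeafF a ts ts₂∈)))

  Unique-insertLeafF : (a : ℕ) (ts : List PTree) → a ∉ labelsF ts → Unique (insertLeafF a ts)
  Unique-insertLeafF a [] _ = []
  Unique-insertLeafF a (t ∷ ts) a∉ =
    Unique.++⁺ (Unique.map⁺ ∷-injectiveˡ (Unique-insertLeaf a t (a∉ ∘ ∈-++⁺ˡ)))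
               (Unique.map⁺ ∷-injectiveʳ (Unique-insertLeafF a ts (a∉ ∘ ∈-++⁺ʳ (labels t)))) disjoint
    where
    disjoint : ∀ {ts′} → ¬ (ts′ ∈ map (_∷ ts) (insertLeaf a t) × ts′ ∈ map (t ∷_) (insertLeafF a ts))
    disjoint (ts′∈₁ , ts′∈₂) with ∈-map⁻ (_∷ ts) ts′∈₁ | ∈-map⁻ (t ∷_) ts′∈₂
    ... | t′ , t′∈ , refl | _ , _ , refl = 1+n≰n (≤-reflexive (sym (↭.↭-length (insertLeaf-labels a t t′∈))))

Unique-incTrees : (m : ℕ) → Unique (incTrees m)
Unique-incTrees zero = [] ∷ []
Unique-incTrees (suc m) =
  Unique-concatMap-inv (insertLeaf a) (removeLeaf a) (Unique-incTrees m)
    (λ T T∈ → Unique-insertLeaf a T (a∉ T∈)) (λ T T′ T∈ T′∈ → removeLeaf-insertLeaf a T (a∉ T∈) T′∈)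
  where
  a = suc (suc m)
  a∉ : ∀ {T} → T ∈ incTrees m → a ∉ labels T
  a∉ T∈ a∈ = 1+n≰n (proj₂ (∈-oneTo⁻ (↭.∈-resp-↭ (proj₂ (incTrees-sound m T∈)) a∈)))

mutual
  degCount≡occ : (d : ℕ) (T : PTree) → degCount d T ≡ occ d (degrees T)
  degCount≡occ d (node a ts) rewrite ≡ᵇ-sym (length ts) d =
    cong ((if d ≡ᵇ length ts then 1 else 0) +_) (degCountF≡occ d ts)

  degCountF≡occ : (d : ℕ) (ts : List PTree) → degCountF d ts ≡ occ d (degreesF ts)
  degCountF≡occ d [] = refl
  degCountF≡occ d (t ∷ ts) rewrite occ-++ d (degrees t) (degreesF ts) =
      cong₂ _+_ (degCount≡occ d t) (degCountF≡occ d ts)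

mutual
  length-degreesF : (ts : List PTree) → length (degreesF ts) ≡ length (labelsF ts)
  length-degreesF [] = refl
  length-degreesF (node b us ∷ ts) rewrite length-++ (degrees (node b us)) {degreesF ts} | length-++
      (labels (node b us)) {labelsF ts} =
    cong₂ _+_ (cong suc (length-degreesF us)) (length-degreesF ts)

-- every vertex but the root is the child of exactly one vertex
mutual
  sum-degrees : (T : PTree) → suc (sum (degrees T)) ≡ length (degrees T)
  sum-degrees (node b ts) = cong suc (trans (+-comm (length ts) (sum (degreesF ts))) (sum-degreesF ts))

  sum-degreesF : (ts : List PTree) → sum (degreesF ts) + length ts ≡ length (degreesF ts)
  sum-degreesF [] = refl
  sum-degreesF (t ∷ ts) rewrite sum-++ (degrees t) (degreesF ts) | length-++ (degrees t) {degreesF ts} =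
    trans (regroup (sum (degrees t)) (sum (degreesF ts)) (length ts)) (cong₂ _+_ (sum-degrees t) (sum-degreesF ts))
    where
    regroup : ∀ a b c → a + b + suc c ≡ suc a + (b + c)
    regroup a b c = trans (+-suc (a + b) c) (cong suc (+-assoc a b c))

mutual
  degrees<length : (T : PTree) → All (_< length (degrees T)) (degrees T)
  degrees<length (node b ts) = s≤s (length≤degreesF ts) ∷ All.map m≤n⇒m≤1+n (degreesF<length ts)

  degreesF<length : (ts : List PTree) → All (_< length (degreesF ts)) (degreesF ts)
  degreesF<length [] = []
  degreesF<length (t ∷ ts) rewrite length-++ (degrees t) {degreesF ts} =
    All.++⁺ (All.map (λ d< → <-≤-trans d< (m≤m+n (length (degrees t)) _)) (degrees<length t))
            (All.map (λ d< → <-≤-trans d< (m≤n+m _ (length (degrees t)))) (degreesF<length ts))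

  length≤degreesF : (ts : List PTree) → length ts ≤ length (degreesF ts)
  length≤degreesF [] = z≤n
  length≤degreesF (node b us ∷ ts) rewrite length-++ (degrees (node b us)) {degreesF ts} =
      +-mono-≤ (s≤s z≤n) (length≤degreesF ts)

mutual
  maxDeg-degrees : (M : ℕ) (T : PTree) → All (_≤ M) (degrees T) → MaxDeg M T
  maxDeg-degrees M (node b ts) (len≤M ∷ ds≤M) = maxDeg len≤M (maxDeg-degreesF M ts ds≤M)

  maxDeg-degreesF : (M : ℕ) (ts : List PTree) → All (_≤ M) (degreesF ts) → All (MaxDeg M) ts
  maxDeg-degreesF M [] _ = []
  maxDeg-degreesF M (t ∷ ts) ds≤M =
      maxDeg-degrees M t (All.++⁻ˡ (degrees t) ds≤M) ∷ maxDeg-degreesF M ts (All.++⁻ʳ (degrees t) ds≤M)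

record DegreeSequence (m : ℕ) (ds : List ℕ) : Set where
  field
    length≡ : length ds ≡ suc m
    sum≡    : sum ds ≡ m
    bounded : All (_≤ m) ds

incTrees-degrees : (m : ℕ) {T : PTree} → T ∈ incTrees m → DegreeSequence m (degrees T)
incTrees-degrees m {T@(node b ts)} T∈ = record
  { length≡ = length≡
  ; sum≡ = suc-injective (trans (sum-degrees T) length≡)
  ; bounded = All.map (λ d< → ≤-pred (≤-trans d< (≤-reflexive length≡))) (degrees<length T)
  }
  where
  length≡ : length (degrees T) ≡ suc m
  length≡ = trans (cong suc (length-degreesF ts))
                  (trans (↭.↭-length (proj₂ (incTrees-sound m T∈)))
                      (trans (length-map suc (upTo (suc m))) (length-applyUpTo id (suc m))))


-- Increasing plane trees and the grammar

-- ∑inc F pre ds post is Σᵢ (dᵢ + 1) · F(pre ++ ds′ ++ post), where ds′ is ds with dᵢ raised by one.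
∑inc : (List ℕ → ℕ) → List ℕ → List ℕ → List ℕ → ℕ
∑inc F pre [] post = 0
∑inc F pre (d ∷ ds) post = suc d * F (pre ++ suc d ∷ ds ++ post) + ∑inc F (pre ++ [ d ]) ds post

∑inc-++ : (F : List ℕ → ℕ) (pre xs ys post : List ℕ) →
          ∑inc F pre (xs ++ ys) post ≡ ∑inc F pre xs (ys ++ post) + ∑inc F (pre ++ xs) ys post
∑inc-++ F pre [] ys post rewrite ++-identityʳ pre = refl
∑inc-++ F pre (d ∷ xs) ys post
  rewrite ∑inc-++ F (pre ++ [ d ]) xs ys post | ++-assoc xs ys post | ++-assoc pre [ d ] xs =
  sym (+-assoc (suc d * F (pre ++ suc d ∷ xs ++ ys ++ post)) _ _)

module _ (F F′ : List ℕ → ℕ) (F-leaf : ∀ xs ys → F (xs ++ 0 ∷ ys) ≡ F′ (xs ++ ys)) where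

  ∑-insertEverywhere : (a : ℕ) (ts : List PTree) (P Q : List ℕ) →
    ∑ (λ ts′ → F (P ++ degreesF ts′ ++ Q)) (insertEverywhere (leaf a) ts) ≡
    suc (length ts) * F′ (P ++ degreesF ts ++ Q)
  ∑-insertEverywhere a [] P Q = trans (+-identityʳ _) (trans (F-leaf P Q) (sym (+-identityʳ _)))
  ∑-insertEverywhere a (t ∷ ts) P Q = begin
    F (P ++ 0 ∷ ds ++ Q) + ∑ (G P) (map (t ∷_) (insertEverywhere (leaf a) ts))
      ≡⟨ cong₂ _+_ (F-leaf P (ds ++ Q)) (∑-map (G P) (t ∷_) (insertEverywhere (leaf a) ts)) ⟩
    F′ (P ++ ds ++ Q) + ∑ (G P ∘ (t ∷_)) (insertEverywhere (leaf a) ts)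
      ≡⟨ cong (F′ (P ++ ds ++ Q) +_)
              (trans (∑-ext (insertEverywhere (leaf a) ts) (λ ts′ → cong F (reassoc (degreesF ts′))))
                     (∑-insertEverywhere a ts (P ++ degrees t) Q)) ⟩
    F′ (P ++ ds ++ Q) + suc (length ts) * F′ ((P ++ degrees t) ++ degreesF ts ++ Q)
      ≡⟨ cong (λ L → F′ (P ++ ds ++ Q) + suc (length ts) * F′ L) (sym (reassoc (degreesF ts))) ⟩
    suc (suc (length ts)) * F′ (P ++ ds ++ Q) ∎
    where
    open ≡-Reasoning
    ds = degreesF (t ∷ ts)
    G : List ℕ → List PTree → ℕ
    G P ts′ = F (P ++ degreesF ts′ ++ Q)
    reassoc : ∀ es → P ++ (degrees t ++ es) ++ Q ≡ (P ++ degrees t) ++ es ++ Q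
    reassoc es = trans (cong (P ++_) (++-assoc (degrees t) es Q)) (sym (++-assoc P (degrees t) _))

  mutual
    ∑-insertLeaf : (a : ℕ) (T : PTree) (pre post : List ℕ) →
                   ∑ (λ T′ → F (pre ++ degrees T′ ++ post)) (insertLeaf a T) ≡ ∑inc F′ pre (degrees T) post
    ∑-insertLeaf a (node b ts) pre post = begin
      ∑ G (map (node b) (insertEverywhere (leaf a) ts) ++ map (node b) (insertLeafF a ts))
        ≡⟨ ∑-++ G (map (node b) (insertEverywhere (leaf a) ts)) _ ⟩
      ∑ G (map (node b) (insertEverywhere (leaf a) ts)) + ∑ G (map (node b) (insertLeafF a ts))
        ≡⟨ cong₂ _+_ (∑-map G (node b) (insertEverywhere (leaf a) ts)) (∑-map G (node b) (insertLeafF a ts)) ⟩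
      ∑ (G ∘ node b) (insertEverywhere (leaf a) ts) + ∑ (G ∘ node b) (insertLeafF a ts)
        ≡⟨ cong₂ _+_ new-child deeper ⟩
      suc d * F′ ((pre ++ [ suc d ]) ++ degreesF ts ++ post) + ∑inc F′ (pre ++ [ d ]) (degreesF ts) post
        ≡⟨ cong (λ L → suc d * F′ L + ∑inc F′ (pre ++ [ d ]) (degreesF ts) post) (++-assoc pre [ suc d ] _) ⟩
      ∑inc F′ pre (degrees (node b ts)) post ∎
      where
      open ≡-Reasoning
      d = length ts
      G : PTree → ℕ
      G T′ = F (pre ++ degrees T′ ++ post)
      regroup : ∀ e ts′ → length ts′ ≡ e → G (node b ts′) ≡ F ((pre ++ [ e ]) ++ degreesF ts′ ++ post)
      regroup e ts′ refl = cong F (sym (++-assoc pre [ length ts′ ] _))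
      new-child : ∑ (G ∘ node b) (insertEverywhere (leaf a) ts) ≡
                  suc d * F′ ((pre ++ [ suc d ]) ++ degreesF ts ++ post)
      new-child = trans (∑-cong (insertEverywhere (leaf a) ts)
                                (λ ts′ ts′∈ → regroup (suc d) ts′ (length-insertEverywhere (leaf a) ts ts′∈)))
                        (∑-insertEverywhere a ts (pre ++ [ suc d ]) post)
      deeper : ∑ (G ∘ node b) (insertLeafF a ts) ≡ ∑inc F′ (pre ++ [ d ]) (degreesF ts) post
      deeper = trans (∑-cong (insertLeafF a ts) (λ ts′ ts′∈ → regroup d ts′ (length-insertLeafF a ts ts′∈)))
                     (∑-insertLeafF a ts (pre ++ [ d ]) post)

    ∑-insertLeafF : (a : ℕ) (ts : List PTree) (pre post : List ℕ) →
                    ∑ (λ ts′ → F (pre ++ degreesF ts′ ++ post)) (insertLeafF a ts) ≡ ∑inc F′ pre (degreesF ts) post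
    ∑-insertLeafF a [] pre post = refl
    ∑-insertLeafF a (t ∷ ts) pre post = begin
      ∑ G (map (_∷ ts) (insertLeaf a t) ++ map (t ∷_) (insertLeafF a ts))
        ≡⟨ ∑-++ G (map (_∷ ts) (insertLeaf a t)) _ ⟩
      ∑ G (map (_∷ ts) (insertLeaf a t)) + ∑ G (map (t ∷_) (insertLeafF a ts))
        ≡⟨ cong₂ _+_ (trans (∑-map G (_∷ ts) (insertLeaf a t)) (∑-ext (insertLeaf a t) reassocˡ))
                     (trans (∑-map G (t ∷_) (insertLeafF a ts)) (∑-ext (insertLeafF a ts) reassocʳ)) ⟩
      ∑ (λ t′ → F (pre ++ degrees t′ ++ degreesF ts ++ post)) (insertLeaf a t)
        + ∑ (λ ts′ → F ((pre ++ degrees t) ++ degreesF ts′ ++ post)) (insertLeafF a ts)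
        ≡⟨ cong₂ _+_ (∑-insertLeaf a t pre (degreesF ts ++ post)) (∑-insertLeafF a ts (pre ++ degrees t) post) ⟩
      ∑inc F′ pre (degrees t) (degreesF ts ++ post) + ∑inc F′ (pre ++ degrees t) (degreesF ts) post
        ≡⟨ sym (∑inc-++ F′ pre (degrees t) (degreesF ts) post) ⟩
      ∑inc F′ pre (degreesF (t ∷ ts)) post ∎
      where
      open ≡-Reasoning
      G : List PTree → ℕ
      G ts′ = F (pre ++ degreesF ts′ ++ post)
      reassocˡ : ∀ t′ → G (t′ ∷ ts) ≡ F (pre ++ degrees t′ ++ degreesF ts ++ post)
      reassocˡ t′ = cong (λ L → F (pre ++ L)) (++-assoc (degrees t′) (degreesF ts) post)
      reassocʳ : ∀ ts′ → G (t ∷ ts′) ≡ F ((pre ++ degrees t) ++ degreesF ts′ ++ post)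
      reassocʳ ts′ =
        cong F (trans (cong (pre ++_) (++-assoc (degrees t) (degreesF ts′) post)) (sym (++-assoc pre (degrees t) _)))

module TreeD (x : ℕ → ℕ) (N : ℕ) where
  open Grammar x N

  cover : List (List Bool) → ℕ → ℕ
  cover [] t = 0
  cover (b ∷ S) t = indicator b t + cover S t

  maskChoices : List ℕ → List (List (List Bool))
  maskChoices [] = [] ∷ []
  maskChoices (d ∷ ds) = concatMap (λ b → map (b ∷_) (maskChoices ds)) (masks N d)

  -- treeD r ds = Dʳ(∏ᵢ e_{N ∸ dᵢ}) with each e_{N ∸ d} expanded as the sum of its monomials, and
  -- treeD⁺ r ds the same with one more factor e_N = x_1 ⋯ x_N.
  treeD treeD⁺ : ℕ → List ℕ → ℕ
  treeD r ds = ∑ (λ S → D r (cover S)) (maskChoices ds)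
  treeD⁺ r ds = ∑ (λ S → D r (suc ∘ cover S)) (maskChoices ds)

  cover-++ : (P Q : List (List Bool)) (t : ℕ) → cover (P ++ Q) t ≡ cover P t + cover Q t
  cover-++ [] Q t = refl
  cover-++ (b ∷ P) Q t rewrite cover-++ P Q t = sym (+-assoc (indicator b t) (cover P t) (cover Q t))

  ∑-maskChoices-∷ : (f : List (List Bool) → ℕ) (d : ℕ) (ds : List ℕ) →
                    ∑ f (maskChoices (d ∷ ds)) ≡ ∑ (λ b → ∑ (λ S → f (b ∷ S)) (maskChoices ds)) (masks N d)
  ∑-maskChoices-∷ f d ds =
      trans (∑-concatMap f _ (masks N d)) (∑-ext (masks N d) (λ b → ∑-map f (b ∷_) (maskChoices ds)))

  ∑-maskChoices-++ : (f : List (List Bool) → ℕ) (xs ys : List ℕ) →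
                     ∑ f (maskChoices (xs ++ ys)) ≡ ∑ (λ P → ∑ (λ Q → f (P ++ Q)) (maskChoices ys)) (maskChoices xs)
  ∑-maskChoices-++ f [] ys = sym (+-identityʳ _)
  ∑-maskChoices-++ f (d ∷ xs) ys = begin
    ∑ f (maskChoices (d ∷ xs ++ ys))
      ≡⟨ ∑-maskChoices-∷ f d (xs ++ ys) ⟩
    ∑ (λ b → ∑ (λ S → f (b ∷ S)) (maskChoices (xs ++ ys))) (masks N d)
      ≡⟨ ∑-ext (masks N d) (λ b → ∑-maskChoices-++ (λ S → f (b ∷ S)) xs ys) ⟩
    ∑ (λ b → ∑ (λ P → ∑ (λ Q → f (b ∷ P ++ Q)) (maskChoices ys)) (maskChoices xs)) (masks N d)
      ≡⟨ sym (∑-maskChoices-∷ (λ P → ∑ (λ Q → f (P ++ Q)) (maskChoices ys)) d xs) ⟩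
    ∑ (λ P → ∑ (λ Q → f (P ++ Q)) (maskChoices ys)) (maskChoices (d ∷ xs)) ∎
    where open ≡-Reasoning

  length-maskChoices : (ds : List ℕ) {S : List (List Bool)} → S ∈ maskChoices ds → All (λ b → length b ≡ N) S
  length-maskChoices [] (here refl) = []
  length-maskChoices (d ∷ ds) S∈ with ∈-concatMap-elim (λ b → map (b ∷_) (maskChoices ds)) {xs = masks N d} S∈
  ... | b , b∈ , S∈′ with ∈-map⁻ (b ∷_) S∈′
  ...   | S , S∈″ , refl = length-masks N d b∈ ∷ length-maskChoices ds S∈″

  -- a leaf contributes the full mask, i.e. the factor e_N
  treeD-leaf : (r : ℕ) (xs ys : List ℕ) → treeD r (xs ++ 0 ∷ ys) ≡ treeD⁺ r (xs ++ ys)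
  treeD-leaf r xs ys = begin
    treeD r (xs ++ 0 ∷ ys)
      ≡⟨ ∑-maskChoices-++ (λ S → D r (cover S)) xs (0 ∷ ys) ⟩
    ∑ (λ P → ∑ (λ Q → D r (cover (P ++ Q))) (maskChoices (0 ∷ ys))) (maskChoices xs)
      ≡⟨ ∑-ext (maskChoices xs) (λ P → trans (∑-maskChoices-∷ (λ Q → D r (cover (P ++ Q))) 0 ys)
                                             (cong (∑ (λ b →
                                                 ∑ (λ S → D r (cover (P ++ b ∷ S)))
                                                     (maskChoices ys))) (masks-zero N))) ⟩
    ∑ (λ P → ∑ (λ S → D r (cover (P ++ replicate N true ∷ S))) (maskChoices ys) + 0) (maskChoices xs)
      ≡⟨ ∑-ext (maskChoices xs)
          (λ P → trans (+-identityʳ _) (∑-ext (maskChoices ys) (λ S → D-cong r (cover-full P S)))) ⟩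
    ∑ (λ P → ∑ (λ Q → D r (suc ∘ cover (P ++ Q))) (maskChoices ys)) (maskChoices xs)
      ≡⟨ sym (∑-maskChoices-++ (λ S → D r (suc ∘ cover S)) xs ys) ⟩
    treeD⁺ r (xs ++ ys) ∎
    where
    open ≡-Reasoning
    cover-full : ∀ P S t → t < N → cover (P ++ replicate N true ∷ S) t ≡ suc (cover (P ++ S) t)
    cover-full P S t t<N rewrite cover-++ P (replicate N true ∷ S) t | cover-++ P S t | indicator-full N t t<N =
      +-suc (cover P t) (cover S t)

  treeD-single : (r : ℕ) → treeD r (0 ∷ []) ≡ D r (λ _ → 1)
  treeD-single r rewrite masks-zero N =
      trans (+-identityʳ _) (D-cong r (λ t t<N → trans (+-identityʳ _) (indicator-full N t t<N)))

  treeD-zero : (ds : List ℕ) → treeD 0 ds ≡ product (map (λ d → ∑ (mono ∘ indicator) (masks N d)) ds)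
  treeD-zero [] = trans (+-identityʳ _) mono-0
  treeD-zero (d ∷ ds) = begin
    treeD 0 (d ∷ ds)
      ≡⟨ ∑-maskChoices-∷ (mono ∘ cover) d ds ⟩
    ∑ (λ b → ∑ (λ S → mono (λ t → indicator b t + cover S t)) (maskChoices ds)) (masks N d)
      ≡⟨ ∑-ext (masks N d) (λ b → trans (∑-ext (maskChoices ds) (λ S → mono-+ (indicator b) (cover S)))
                                         (∑-*ˡ (mono (indicator b)) _ (maskChoices ds))) ⟩
    ∑ (λ b → mono (indicator b) * treeD 0 ds) (masks N d)
      ≡⟨ ∑-*ʳ (treeD 0 ds) _ (masks N d) ⟩
    ∑ (mono ∘ indicator) (masks N d) * treeD 0 ds
      ≡⟨ cong (∑ (mono ∘ indicator) (masks N d) *_) (treeD-zero ds) ⟩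
    ∑ (mono ∘ indicator) (masks N d) * product (map (λ d → ∑ (mono ∘ indicator) (masks N d)) ds) ∎
    where open ≡-Reasoning

  -- the terms of D(x^{cover (P ++ S)}) differentiating a variable of a mask in S, each regrouped as
  -- that mask with the variable cleared, times e_N
  dropOneSum : ℕ → List (List Bool) → List (List Bool) → ℕ
  dropOneSum r P [] = 0
  dropOneSum r P (b ∷ S) = ∑ (λ b′ → D r (suc ∘ cover (P ++ b′ ∷ S))) (dropOne b) + dropOneSum r (P ++ [ b ]) S

  raiseExcept-cover : (P S : List (List Bool)) (b : List Bool) (t s : ℕ) → indicator b t ≡ 1 →
                      raiseExcept t (cover (P ++ b ∷ S)) s ≡ suc (cover (P ++ clear t b ∷ S) s)
  raiseExcept-cover P S b t s bt≡1
    rewrite cover-++ P (b ∷ S) s | cover-++ P (clear t b ∷ S) s | indicator-clear t b s with s ≡ᵇ t in s≡ᵇt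
  ... | true rewrite ≡ᵇ-true⇒≡ s t s≡ᵇt | bt≡1 = +-suc (cover P t) (cover S t)
  ... | false = refl

  ∑<-cover≡dropOneSum : (r : ℕ) (P S : List (List Bool)) → All (λ b → length b ≡ N) S →
                        ∑< N (λ t → cover S t * D r (raiseExcept t (cover (P ++ S)))) ≡ dropOneSum r P S
  ∑<-cover≡dropOneSum r P [] _ = ∑<-0 N
  ∑<-cover≡dropOneSum r P (b ∷ S) (refl ∷ lengths) = begin
    ∑< (length b) (λ t → (indicator b t + cover S t) * H t)
      ≡⟨ ∑<-cong (length b) (λ t _ → *-distribʳ-+ (H t) (indicator b t) (cover S t)) ⟩
    ∑< (length b) (λ t → indicator b t * H t + cover S t * H t)
      ≡⟨ ∑<-+ (length b) _ _ ⟩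
    ∑< (length b) (λ t → indicator b t * H t) + ∑< (length b) (λ t → cover S t * H t)
      ≡⟨ cong₂ _+_ clearings rest ⟩
    ∑ (λ b′ → D r (suc ∘ cover (P ++ b′ ∷ S))) (dropOne b) + dropOneSum r (P ++ [ b ]) S ∎
    where
    open ≡-Reasoning
    H : ℕ → ℕ
    H t = D r (raiseExcept t (cover (P ++ b ∷ S)))
    clearings : ∑< (length b) (λ t → indicator b t * H t) ≡ ∑ (λ b′ → D r (suc ∘ cover (P ++ b′ ∷ S))) (dropOne b)
    clearings = begin
      ∑< (length b) (λ t → indicator b t * H t)
        ≡⟨ ∑<-indicator b H ⟩
      ∑ H (truePositions b)
        ≡⟨ ∑-cong (truePositions b)
            (λ t t∈ → D-cong r (λ s _ → raiseExcept-cover P S b t s (indicator-truePositions b t∈))) ⟩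
      ∑ (λ t → D r (suc ∘ cover (P ++ clear t b ∷ S))) (truePositions b)
        ≡⟨ sym (∑-map (λ b′ → D r (suc ∘ cover (P ++ b′ ∷ S))) (λ t → clear t b) (truePositions b)) ⟩
      ∑ (λ b′ → D r (suc ∘ cover (P ++ b′ ∷ S))) (map (λ t → clear t b) (truePositions b))
        ≡⟨ cong (∑ (λ b′ → D r (suc ∘ cover (P ++ b′ ∷ S)))) (sym (dropOne≡map-clear b)) ⟩
      ∑ (λ b′ → D r (suc ∘ cover (P ++ b′ ∷ S))) (dropOne b) ∎
    rest : ∑< (length b) (λ t → cover S t * H t) ≡ dropOneSum r (P ++ [ b ]) S
    rest = subst (λ L → ∑< (length b) (λ t → cover S t * D r (raiseExcept t (cover L))) ≡ dropOneSum r (P ++ [ b ]) S)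
                 (++-assoc P [ b ] S) (∑<-cover≡dropOneSum r (P ++ [ b ]) S lengths)

  ∑-dropOne-maskChoices : (d : ℕ) (ds : List ℕ) (h : List (List Bool) → ℕ) →
    ∑ (λ b → ∑ (λ S → ∑ (λ b′ → h (b′ ∷ S)) (dropOne b)) (maskChoices ds)) (masks N d) ≡
    suc d * ∑ h (maskChoices (suc d ∷ ds))
  ∑-dropOne-maskChoices d ds h = begin
    ∑ (λ b → ∑ (λ S → ∑ (λ b′ → h (b′ ∷ S)) (dropOne b)) (maskChoices ds)) (masks N d)
      ≡⟨ ∑-comm _ (masks N d) (maskChoices ds) ⟩
    ∑ (λ S → ∑ (λ b → ∑ (λ b′ → h (b′ ∷ S)) (dropOne b)) (masks N d)) (maskChoices ds)
      ≡⟨ ∑-ext (maskChoices ds) (λ S → ∑-dropOne N d (λ b′ → h (b′ ∷ S))) ⟩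
    ∑ (λ S → suc d * ∑ (λ b′ → h (b′ ∷ S)) (masks N (suc d))) (maskChoices ds)
      ≡⟨ ∑-*ˡ (suc d) _ (maskChoices ds) ⟩
    suc d * ∑ (λ S → ∑ (λ b′ → h (b′ ∷ S)) (masks N (suc d))) (maskChoices ds)
      ≡⟨ cong (suc d *_) (∑-comm _ (maskChoices ds) (masks N (suc d))) ⟩
    suc d * ∑ (λ b′ → ∑ (λ S → h (b′ ∷ S)) (maskChoices ds)) (masks N (suc d))
      ≡⟨ cong (suc d *_) (sym (∑-maskChoices-∷ h (suc d) ds)) ⟩
    suc d * ∑ h (maskChoices (suc d ∷ ds)) ∎
    where open ≡-Reasoning

  ∑-dropOneSum : (r : ℕ) (pre ds : List ℕ) →
    ∑ (λ P → ∑ (dropOneSum r P) (maskChoices ds)) (maskChoices pre) ≡ ∑inc (treeD⁺ r) pre ds []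
  ∑-dropOneSum r pre [] = ∑-0 (maskChoices pre)
  ∑-dropOneSum r pre (d ∷ ds) = begin
    ∑ (λ P → ∑ (dropOneSum r P) (maskChoices (d ∷ ds))) (maskChoices pre)
      ≡⟨ ∑-ext (maskChoices pre) split ⟩
    ∑ (λ P → X P + Y P) (maskChoices pre)
      ≡⟨ ∑-+ X Y (maskChoices pre) ⟩
    ∑ X (maskChoices pre) + ∑ Y (maskChoices pre)
      ≡⟨ cong₂ _+_ ∑X ∑Y ⟩
    suc d * treeD⁺ r (pre ++ suc d ∷ ds ++ []) + ∑inc (treeD⁺ r) (pre ++ [ d ]) ds [] ∎
    where
    open ≡-Reasoning
    h : List (List Bool) → List (List Bool) → ℕ
    h P S = D r (suc ∘ cover (P ++ S))
    X Y : List (List Bool) → ℕ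
    X P = ∑ (λ b → ∑ (λ S → ∑ (λ b′ → h P (b′ ∷ S)) (dropOne b)) (maskChoices ds)) (masks N d)
    Y P = ∑ (λ b → ∑ (dropOneSum r (P ++ [ b ])) (maskChoices ds)) (masks N d)
    split : ∀ P → ∑ (dropOneSum r P) (maskChoices (d ∷ ds)) ≡ X P + Y P
    split P = trans (∑-maskChoices-∷ (dropOneSum r P) d ds)
                    (trans (∑-ext (masks N d) (λ b → ∑-+ _ (dropOneSum r (P ++ [ b ])) (maskChoices ds)))
                           (∑-+ _ _ (masks N d)))
    ∑X : ∑ X (maskChoices pre) ≡ suc d * treeD⁺ r (pre ++ suc d ∷ ds ++ [])
    ∑X = begin
      ∑ X (maskChoices pre)
        ≡⟨ ∑-ext (maskChoices pre) (λ P → ∑-dropOne-maskChoices d ds (h P)) ⟩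
      ∑ (λ P → suc d * ∑ (h P) (maskChoices (suc d ∷ ds))) (maskChoices pre)
        ≡⟨ ∑-*ˡ (suc d) _ (maskChoices pre) ⟩
      suc d * ∑ (λ P → ∑ (h P) (maskChoices (suc d ∷ ds))) (maskChoices pre)
        ≡⟨ cong (suc d *_) (sym (∑-maskChoices-++ (λ S → D r (suc ∘ cover S)) pre (suc d ∷ ds))) ⟩
      suc d * treeD⁺ r (pre ++ suc d ∷ ds)
        ≡⟨ cong (λ L → suc d * treeD⁺ r (pre ++ suc d ∷ L)) (sym (++-identityʳ ds)) ⟩
      suc d * treeD⁺ r (pre ++ suc d ∷ ds ++ []) ∎
    ∑Y : ∑ Y (maskChoices pre) ≡ ∑inc (treeD⁺ r) (pre ++ [ d ]) ds []
    ∑Y = begin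
      ∑ Y (maskChoices pre)
        ≡⟨ ∑-ext (maskChoices pre) (λ P → trans (∑-ext (masks N d) (λ b → sym (+-identityʳ _)))
                                                (sym (∑-maskChoices-∷ _ d []))) ⟩
      ∑ (λ P → ∑ (λ Q → ∑ (dropOneSum r (P ++ Q)) (maskChoices ds)) (maskChoices (d ∷ []))) (maskChoices pre)
        ≡⟨ sym (∑-maskChoices-++ (λ P′ → ∑ (dropOneSum r P′) (maskChoices ds)) pre [ d ]) ⟩
      ∑ (λ P′ → ∑ (dropOneSum r P′) (maskChoices ds)) (maskChoices (pre ++ [ d ]))
        ≡⟨ ∑-dropOneSum r (pre ++ [ d ]) ds ⟩
      ∑inc (treeD⁺ r) (pre ++ [ d ]) ds [] ∎

  treeD-suc : (r : ℕ) (ds : List ℕ) → treeD (suc r) ds ≡ ∑inc (treeD⁺ r) [] ds []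
  treeD-suc r ds = trans (∑-cong (maskChoices ds) (λ S S∈ → ∑<-cover≡dropOneSum r [] S (length-maskChoices ds S∈)))
                         (trans (sym (+-identityʳ _)) (∑-dropOneSum r [] ds))

  ∑-treeD-incTrees-suc : (m r : ℕ) →
      ∑ (treeD r ∘ degrees) (incTrees (suc m)) ≡ ∑ (treeD (suc r) ∘ degrees) (incTrees m)
  ∑-treeD-incTrees-suc m r = begin
    ∑ (treeD r ∘ degrees) (concatMap (insertLeaf a) (incTrees m))
      ≡⟨ ∑-concatMap (treeD r ∘ degrees) (insertLeaf a) (incTrees m) ⟩
    ∑ (λ T → ∑ (treeD r ∘ degrees) (insertLeaf a T)) (incTrees m)
      ≡⟨ ∑-ext (incTrees m)
          (λ T → trans (∑-ext (insertLeaf a T) (λ T′ → cong (treeD r) (sym (++-identityʳ (degrees T′)))))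
                                         (∑-insertLeaf (treeD r) (treeD⁺ r) (treeD-leaf r) a T [] [])) ⟩
    ∑ (λ T → ∑inc (treeD⁺ r) [] (degrees T) []) (incTrees m)
      ≡⟨ ∑-ext (incTrees m) (λ T → sym (treeD-suc r (degrees T))) ⟩
    ∑ (treeD (suc r) ∘ degrees) (incTrees m) ∎
    where
    open ≡-Reasoning
    a = suc (suc m)

  ∑-treeD-incTrees : (m r : ℕ) → ∑ (treeD r ∘ degrees) (incTrees m) ≡ D (m + r) (λ _ → 1)
  ∑-treeD-incTrees zero r = trans (+-identityʳ _) (treeD-single r)
  ∑-treeD-incTrees (suc m) r = begin
    ∑ (treeD r ∘ degrees) (incTrees (suc m))    ≡⟨ ∑-treeD-incTrees-suc m r ⟩
    ∑ (treeD (suc r) ∘ degrees) (incTrees m)    ≡⟨ ∑-treeD-incTrees m (suc r) ⟩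
    D (m + suc r) (λ _ → 1)                     ≡⟨ cong (λ i → D i (λ _ → 1)) (+-suc m r) ⟩
    D (suc m + r) (λ _ → 1)                     ∎
    where open ≡-Reasoning


-- Degree profiles

-- each entry d contributes 1 (plus m ∸ 1 if d = m) on the left and d (plus 1 if d = 0) on the right
length+occ*pred≤sum+leaves : (m : ℕ) → 1 ≤ m → (ds : List ℕ) → length ds + occ m ds * (m ∸ 1) ≤ sum ds + occ 0 ds
length+occ*pred≤sum+leaves m m≥1 [] = z≤n
length+occ*pred≤sum+leaves m m≥1 (zero ∷ ds)
  rewrite ≢⇒≡ᵇ-false m 0 (≢-sym (<⇒≢ m≥1)) | +-suc (sum ds) (occ 0 ds) = s≤s (length+occ*pred≤sum+leaves m m≥1 ds)
length+occ*pred≤sum+leaves m m≥1 (suc d ∷ ds) with m ≡ᵇ suc d in m≡ᵇ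
... | false =
    s≤s (≤-trans (length+occ*pred≤sum+leaves m m≥1 ds)
        (≤-trans (m≤n+m _ d) (≤-reflexive (sym (+-assoc d (sum ds) (occ 0 ds))))))
... | true with ≡ᵇ-true⇒≡ m (suc d) m≡ᵇ
...   | refl = s≤s (begin
  length ds + (d + occ (suc d) ds * d)   ≡⟨ +-left-comm (length ds) d _ ⟩
  d + (length ds + occ (suc d) ds * d)   ≤⟨ +-monoʳ-≤ d (length+occ*pred≤sum+leaves (suc d) m≥1 ds) ⟩
  d + (sum ds + occ 0 ds)                ≡⟨ sym (+-assoc d (sum ds) (occ 0 ds)) ⟩
  d + sum ds + occ 0 ds                  ∎)
  where
  open ≤-Reasoning

occ*≤sum : (v : ℕ) (ds : List ℕ) → occ v ds * v ≤ sum ds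
occ*≤sum v [] = z≤n
occ*≤sum v (d ∷ ds) with v ≡ᵇ d in v≡ᵇd
... | true rewrite ≡ᵇ-true⇒≡ v d v≡ᵇd = +-monoʳ-≤ d (occ*≤sum d ds)
... | false = ≤-trans (occ*≤sum v ds) (m≤n+m (sum ds) d)

all-leaves⇒sum≡0 : (ds : List ℕ) → occ 0 ds ≡ length ds → sum ds ≡ 0
all-leaves⇒sum≡0 [] _ = refl
all-leaves⇒sum≡0 (zero ∷ ds) eq = all-leaves⇒sum≡0 ds (suc-injective eq)
all-leaves⇒sum≡0 (suc d ∷ ds) eq = ⊥-elim (1+n≰n (≤-trans (≤-reflexive (sym eq)) (occ≤length 0 ds)))

degreeProfile : ℕ → List ℕ → List ℕ
degreeProfile n ds = map (λ d → occ d ds) (upTo n)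

nth-degreeProfile : (n : ℕ) (ds : List ℕ) (i : ℕ) → i < n → nth (degreeProfile n ds) i ≡ occ i ds
nth-degreeProfile n ds i i<n = trans (cong (λ L → nth L i) (map-applyUpTo id _ n)) (nth-applyUpTo n i i<n)
  where
  nth-applyUpTo : ∀ {f : ℕ → ℕ} n i → i < n → nth (applyUpTo f n) i ≡ f i
  nth-applyUpTo (suc n) zero _ = refl
  nth-applyUpTo (suc n) (suc i) (s≤s i<n) = nth-applyUpTo n i i<n

length-degreeProfile : (n : ℕ) (ds : List ℕ) → length (degreeProfile n ds) ≡ n
length-degreeProfile n ds = trans (length-map _ (upTo n)) (length-applyUpTo id n)

validSeq-intro : (n : ℕ) (is : List ℕ) → sum is ≡ n → 1 ≤ first is → first is ≤ n ∸ 1 → lastOf is ≤ 1 →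
                 (lastOf is ≡ 1 → first is ≡ n ∸ 1) → validSeq n is ≡ true
validSeq-intro n is sum≡n 1≤first first≤ last≤1 last⇒first
  rewrite sum≡n | ≡ᵇ-refl n | ≤⇒≤ᵇ-true 1 (first is) 1≤first | ≤⇒≤ᵇ-true (first is) (n ∸ 1) first≤
        | ≤⇒≤ᵇ-true (lastOf is) 1 last≤1 with lastOf is ≡ᵇ 1 in last≡ᵇ1
... | false = refl
... | true rewrite last⇒first (≡ᵇ-true⇒≡ _ 1 last≡ᵇ1) | ≡ᵇ-refl (n ∸ 1) = refl

-- The degree profile (i₁, …, i_{m+1}) of a tree on m + 1 vertices satisfies the summation conditions:
-- there is a leaf, not every vertex is a leaf, and a vertex of degree m is unique and forces all the
-- others to be leaves.
degreeProfile-valid : (m : ℕ) → 1 ≤ m →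
    (ds : List ℕ) → DegreeSequence m ds → validSeq (suc m) (degreeProfile (suc m) ds) ≡ true
degreeProfile-valid m m≥1 ds ds-seq =
  validSeq-intro (suc m) is sum-is (subst (1 ≤_) (sym first≡) 1≤leaves) (subst (_≤ m) (sym first≡) leaves≤m)
                 (subst (_≤ 1) (sym last≡) top≤1) (λ last≡1 → trans first≡ (top⇒leaves (trans (sym last≡) last≡1)))
  where
  open DegreeSequence ds-seq
  is = degreeProfile (suc m) ds
  leaves = occ 0 ds
  first≡ : first is ≡ leaves
  first≡ = nth-degreeProfile (suc m) ds 0 (s≤s z≤n)
  last≡ : lastOf is ≡ occ m ds
  last≡ = trans (cong (λ L → nth is (L ∸ 1)) (length-degreeProfile (suc m) ds))
      (nth-degreeProfile (suc m) ds m ≤-refl)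
  sum-is : sum is ≡ suc m
  sum-is = begin
    sum (map (λ d → occ d ds) (upTo (suc m)))  ≡⟨ ∑-upTo (λ d → occ d ds) (suc m) ⟩
    ∑< (suc m) (λ d → occ d ds)                ≡⟨ ∑<-cong (suc m) (λ d _ → sym (*-identityʳ (occ d ds))) ⟩
    ∑< (suc m) (λ d → occ d ds * 1)            ≡⟨ ∑<-occ (suc m) (λ _ → 1) ds (All.map s≤s bounded) ⟩
    ∑ (λ _ → 1) ds                             ≡⟨ ∑-1 ds ⟩
    length ds                                  ≡⟨ length≡ ⟩
    suc m                                      ∎
    where open ≡-Reasoning
  counting : suc m + occ m ds * (m ∸ 1) ≤ m + leaves
  counting = subst₂ (λ L S → L + occ m ds * (m ∸ 1) ≤ S + leaves) length≡ sum≡ (length+occ*pred≤sum+leaves m m≥1 ds)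
  1≤leaves : 1 ≤ leaves
  1≤leaves = +-cancelˡ-≤ m 1 leaves (≤-trans (≤-reflexive (+-comm m 1)) (≤-trans (m≤m+n (suc m) _) counting))
  leaves≤m : leaves ≤ m
  leaves≤m with m≤n⇒m<n∨m≡n (subst (leaves ≤_) length≡ (occ≤length 0 ds))
  ... | inj₁ leaves<1+m = ≤-pred leaves<1+m
  ... | inj₂ leaves≡1+m =
      ⊥-elim (<⇒≢ m≥1 (sym (trans (sym sum≡) (all-leaves⇒sum≡0 ds (trans leaves≡1+m (sym length≡))))))
  top≤1 : occ m ds ≤ 1
  top≤1 = *-cancelʳ-≤ (occ m ds) 1 m {{>-nonZero m≥1}}
      (≤-trans (occ*≤sum m ds) (≤-reflexive (trans sum≡ (sym (*-identityˡ m)))))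
  top⇒leaves : occ m ds ≡ 1 → leaves ≡ m
  top⇒leaves top≡1 = ≤-antisym leaves≤m (+-cancelˡ-≤ m m leaves (≤-trans (≤-reflexive m+m) counting))
    where
    m+m : m + m ≡ suc m + occ m ds * (m ∸ 1)
    m+m rewrite top≡1 | +-identityʳ (m ∸ 1) =
        trans (cong (m +_) (sym (trans (+-comm 1 (m ∸ 1)) (m∸n+n≡m m≥1)))) (+-suc m (m ∸ 1))

Unique-Seqs : (n : ℕ) → Unique (Seqs n)
Unique-Seqs n =
    Unique.filter⁺ _ (subst Unique (sym (seqs≡tuples n n)) (Unique-tuples (upTo (suc n)) n (Unique.upTo⁺ (suc n))))

length-∈-Seqs : (n : ℕ) {is : List ℕ} → is ∈ Seqs n → length is ≡ n
length-∈-Seqs n is∈ =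
    proj₁ (∈-tuples⁻ (upTo (suc n)) n (subst (_ ∈_) (seqs≡tuples n n) (proj₁ (∈-filterᵇ⁻ (validSeq n) is∈))))

degreeProfile-∈-Seqs : (m : ℕ) → 1 ≤ m → {T : PTree} → T ∈ incTrees m →
    degreeProfile (suc m) (degrees T) ∈ Seqs (suc m)
degreeProfile-∈-Seqs m m≥1 {T} T∈ =
  ∈-filterᵇ⁺ (validSeq (suc m)) (subst (is ∈_) (sym (seqs≡tuples (suc m) (suc m))) is∈tuples)
      (degreeProfile-valid m m≥1 ds ds-seq)
  where
  ds = degrees T
  is = degreeProfile (suc m) ds
  ds-seq = incTrees-degrees m T∈
  is∈tuples : is ∈ tuples (upTo (suc (suc m))) (suc m)
  is∈tuples = subst (λ L → is ∈ tuples (upTo (suc (suc m))) L) (length-degreeProfile (suc m) ds)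
    (∈-tuples⁺ (upTo (suc (suc m))) is
      (All.map⁺ (All.tabulate
          (λ {d} _ → ∈-upTo⁺ (s≤s (subst (occ d ds ≤_) (DegreeSequence.length≡ ds-seq) (occ≤length d ds)))))))

nth-ext : (xs ys : List ℕ) → length xs ≡ length ys → (∀ i → i < length xs → nth xs i ≡ nth ys i) → xs ≡ ys
nth-ext [] [] _ _ = refl
nth-ext (x ∷ xs) (y ∷ ys) len≡ nth≡ =
  cong₂ _∷_ (nth≡ 0 (s≤s z≤n)) (nth-ext xs ys (suc-injective len≡) (λ i i< → nth≡ (suc i) (s≤s i<)))

module _ (m k : ℕ) (m≥1 : 1 ≤ m) (m≤1+k : m ≤ suc k) (x : ℕ → ℕ) where
  open Grammar x (suc k)
  open TreeD x (suc k)

  private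
    n = suc m

  profile : PTree → List ℕ
  profile T = degreeProfile n (degrees T)

  profile≟ : (is : List ℕ) (T : PTree) → Dec (profile T ≡ is)
  profile≟ is T = ≡-dec _≟_ (profile T) is

  goodTrees : List ℕ → List PTree
  goodTrees is = filter (profile≟ is) (incTrees m)

  goodTree⇒∈ : {is : List ℕ} {T : PTree} → is ∈ Seqs n → GoodTree n k is T → T ∈ goodTrees is
  goodTree⇒∈ {is} {T} is∈ (incT , _ , counts) =
      ∈-filter⁺ (profile≟ is) (incTrees-complete m incT) profile≡
    where
    profile≡ : profile T ≡ is
    profile≡ = nth-ext (profile T) is (trans (length-degreeProfile n (degrees T)) (sym (length-∈-Seqs n is∈)))
      (λ i i< → let i<n = subst (i <_) (length-degreeProfile n (degrees T)) i< in
                trans (nth-degreeProfile n (degrees T) i i<n)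
                    (trans (sym (degCount≡occ i T)) (counts (suc i) (s≤s z≤n) i<n)))

  ∈⇒goodTree : {is : List ℕ} {T : PTree} → T ∈ goodTrees is → GoodTree n k is T
  ∈⇒goodTree {is} {T} T∈ with ∈-filter⁻ (profile≟ is) {xs = incTrees m} T∈
  ... | T∈′ , refl =
    incTrees-sound m T∈′ ,
    maxDeg-degrees (suc k) T (All.map (λ d≤m → ≤-trans d≤m m≤1+k) (DegreeSequence.bounded (incTrees-degrees m T∈′))) ,
    λ { (suc j) _ j<n → trans (degCount≡occ j T) (sym (nth-degreeProfile n (degrees T) j j<n)) }

  count≡length-goodTrees : {is : List ℕ} {c : ℕ} → is ∈ Seqs n → IsCount (GoodTree n k is) c →
      c ≡ length (goodTrees is)
  count≡length-goodTrees {is} is∈ (L , unique-L , L⇒good , good⇒L , length≡c) = begin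
    _                     ≡⟨ sym length≡c ⟩
    length L              ≡⟨ sym (∑-1 L) ⟩
    ∑ (λ _ → 1) L         ≡⟨ ∑-unique-cong (λ _ → 1) unique-L (Unique.filter⁺ _ (Unique-incTrees m))
                               (λ T T∈ → goodTree⇒∈ is∈ (L⇒good T T∈)) (λ T T∈ → good⇒L T (∈⇒goodTree T∈)) ⟩
    ∑ (λ _ → 1) (goodTrees is) ≡⟨ ∑-1 (goodTrees is) ⟩
    length (goodTrees is) ∎
    where open ≡-Reasoning

  eMono-profile : {T : PTree} → T ∈ incTrees m → eMono n k x (profile T) ≡ treeD 0 (degrees T)
  eMono-profile {T} T∈ = begin
    product (map (λ j → e k x (k + 2 ∸ j) ^ nth (profile T) (j ∸ 1)) (oneTo n))
      ≡⟨ cong product (trans (sym (map-∘ {g = F} {f = suc} (upTo n))) (map-upTo (F ∘ suc) n)) ⟩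
    ∏< n (λ d → e k x (k + 2 ∸ suc d) ^ nth (profile T) d)
      ≡⟨ ∏<-cong n
          (λ d d<n → cong₂ _^_ (cong (λ i → e k x (i ∸ suc d)) (+-comm k 2)) (nth-degreeProfile n ds d d<n)) ⟩
    ∏< n (λ d → f d ^ occ d ds)
      ≡⟨ ∏<-occ n f ds (All.map s≤s (DegreeSequence.bounded ds-seq)) ⟩
    product (map f ds)
      ≡⟨ cong product (map-cong-local (All.tabulate (λ {d} d∈ →
           trans (cong (λ ys → esym ys (suc k ∸ d)) variables)
                 (sym (∑-masks-mono x (suc k) d (≤-trans (All.lookup (DegreeSequence.bounded ds-seq) d∈) m≤1+k)))))) ⟩
    product (map (λ d → ∑ (mono ∘ indicator) (masks (suc k) d)) ds)
      ≡⟨ sym (treeD-zero ds) ⟩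
    treeD 0 ds ∎
    where
    open ≡-Reasoning
    ds = degrees T
    ds-seq = incTrees-degrees m T∈
    f : ℕ → ℕ
    f d = e k x (suc k ∸ d)
    F : ℕ → ℕ
    F j = e k x (k + 2 ∸ j) ^ nth (profile T) (j ∸ 1)
    variables : map x (oneTo (suc k)) ≡ applyUpTo (x ∘ suc) (suc k)
    variables = trans (sym (map-∘ (upTo (suc k)))) (map-upTo (x ∘ suc) (suc k))

  ∑-goodTrees : (is : List ℕ) → ∑ (eMono n k x ∘ profile) (goodTrees is) ≡ length (goodTrees is) * eMono n k x is
  ∑-goodTrees is = trans (∑-cong (goodTrees is) profile≡) (∑-const (eMono n k x is) (goodTrees is))
    where
    profile≡ : ∀ T → T ∈ goodTrees is → eMono n k x (profile T) ≡ eMono n k x is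
    profile≡ T T∈ = cong (eMono n k x) (proj₂ (∈-filter⁻ (profile≟ is) {xs = incTrees m} T∈))

  ∑-goodTrees-Seqs : (h : PTree → ℕ) → ∑ h (concatMap goodTrees (Seqs n)) ≡ ∑ h (incTrees m)
  ∑-goodTrees-Seqs h = ∑-unique-cong h
    (Unique-concatMap-inv goodTrees profile (Unique-Seqs n) (λ is _ → Unique.filter⁺ _ (Unique-incTrees m))
      (λ is T _ T∈ → proj₂ (∈-filter⁻ (profile≟ is) {xs = incTrees m} T∈)))
    (Unique-incTrees m)
    (λ T T∈ → let is , _ , T∈′ = ∈-concatMap-elim goodTrees {xs = Seqs n} T∈ in
              proj₁ (∈-filter⁻ (profile≟ is) {xs = incTrees m} T∈′))
    (λ T T∈ → ∈-concatMap-intro goodTrees (degreeProfile-∈-Seqs m m≥1 T∈)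
                (∈-filter⁺ (profile≟ (profile T)) T∈ refl))

  ∑-γ·eMono : (γ : List ℕ → ℕ) → (∀ is → IsCount (GoodTree n k is) (γ is)) →
              ∑ (λ is → γ is * eMono n k x is) (Seqs n) ≡ D m (λ _ → 1)
  ∑-γ·eMono γ γ-counts = begin
    ∑ (λ is → γ is * eMono n k x is) (Seqs n)
      ≡⟨ ∑-cong (Seqs n) (λ is is∈ → cong (_* eMono n k x is) (count≡length-goodTrees is∈ (γ-counts is))) ⟩
    ∑ (λ is → length (goodTrees is) * eMono n k x is) (Seqs n)
      ≡⟨ ∑-ext (Seqs n) (λ is → sym (∑-goodTrees is)) ⟩
    ∑ (λ is → ∑ (eMono n k x ∘ profile) (goodTrees is)) (Seqs n)
      ≡⟨ sym (∑-concatMap (eMono n k x ∘ profile) goodTrees (Seqs n)) ⟩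
    ∑ (eMono n k x ∘ profile) (concatMap goodTrees (Seqs n))
      ≡⟨ ∑-goodTrees-Seqs (eMono n k x ∘ profile) ⟩
    ∑ (eMono n k x ∘ profile) (incTrees m)
      ≡⟨ ∑-cong (incTrees m) (λ T T∈ → eMono-profile T∈) ⟩
    ∑ (treeD 0 ∘ degrees) (incTrees m)
      ≡⟨ ∑-treeD-incTrees m 0 ⟩
    D (m + 0) (λ _ → 1)
      ≡⟨ cong (λ i → D i (λ _ → 1)) (+-identityʳ m) ⟩
    D m (λ _ → 1) ∎
    where open ≡-Reasoning

theorem4p8 : (n k : ℕ) → 2 ≤ n → 1 ≤ k → n ≤ k + 2 →
    (γ : List ℕ → ℕ) → (∀ is → IsCount (GoodTree n k is) (γ is)) →
    (x : ℕ → ℕ) →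
      C n k x ≡ sum (map (λ is → γ is * eMono n k x is) (Seqs n))
theorem4p8 (suc (suc j)) k (s≤s (s≤s _)) k≥1 n≤k+2 γ γ-counts x = begin
  C (suc (suc j)) k x
    ≡⟨ C≡D k x k≥1 (suc j) ⟩
  Grammar.D x (suc k) (suc j) (λ _ → 1)
    ≡⟨ sym (∑-γ·eMono (suc j) k (s≤s z≤n) 1+j≤1+k x γ γ-counts) ⟩
  sum (map (λ is → γ is * eMono (suc (suc j)) k x is) (Seqs (suc (suc j)))) ∎
  where
  open ≡-Reasoning
  1+j≤1+k : suc j ≤ suc k
  1+j≤1+k = ≤-pred (subst (suc (suc j) ≤_) (+-comm k 2) n≤k+2)
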